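{- For all integers $n,r,s\ge0$, \[ \sum_{k=1}^{n}h_{k}^{(r)}h_{n+1-k}^{(s)}=2\sum_{k=1}^{n}\binom{n+r+s}{k+r+s}\frac{(-1)^{k+1}}{k+1}H_{k}, \] and, for every non-negative integer $m$, \[ \sum_{l=0}^{n}h_{l+1}^{(r-1)}h_{n-l}^{(r)}=\frac{1}{n!}\sum_{k=1}^{n}(-1)^{k+1}\genfrac{[}{]}{0pt}{}{n}{k}_{m}\,k\,B_{k-1}(m-2r+1). \]
   Context: For an integer $r$ (possibly negative) and $n\ge0$, the hyperharmonic number $h_n^{(r)}$ is the coefficient of $t^n$ in $\frac{ -\ln(1-t)}{(1-t)^r}$; for $r\ge1$ this agrees with $h_n^{(r)}=\sum_{k=1}^n h_k^{(r-1)}$, $h_k^{(0)}=1/k$, and $h_0^{(r)}=0$. $H_k=1+\frac12+\cdots+\frac1k$. The $r$-Stirling numbers of the first kind are defined by $(x+m)^{\overline{n}}=\sum_{k=0}^n\genfrac{[}{]}{0pt}{}{n}{k}_m x^k$, where $(x)^{\overline{n}}=x(x+1)\cdots(x+n-1)$. $B_n(x)$ are the Bernoulli polynomials, $\sum_{n\ge0}B_n(x)\frac{t^n}{n!}=\frac{te^{xt}}{e^t-1}$. -}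

module Defs where

open import Data.Nat as ℕ using (ℕ; zero; suc; _∸_; _!)
open import Data.Nat.Properties using (_!≢0)
open import Data.Nat.Combinatorics using (_C_)
open import Data.Integer as ℤ using (ℤ; +_)
open import Data.Rational using (ℚ; _/_; 0ℚ; 1ℚ; _+_; _*_; -_)
open import Data.List using (List; []; _∷_; length)

Σ₁ : ℕ → (ℕ → ℚ) → ℚ
Σ₁ zero    f = 0ℚ
Σ₁ (suc n) f = Σ₁ n f + f (suc n)

Σ₀ : ℕ → (ℕ → ℚ) → ℚ
Σ₀ zero    f = f 0
Σ₀ (suc n) f = Σ₀ n f + f (suc n)

ℕ→ℚ : ℕ → ℚ
ℕ→ℚ n = + n / 1

ℤ→ℚ : ℤ → ℚ
ℤ→ℚ z = z / 1

_^ℚ_ : ℚ → ℕ → ℚ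
x ^ℚ zero  = 1ℚ
x ^ℚ suc k = x * (x ^ℚ k)

sgn : ℕ → ℚ
sgn zero    = 1ℚ
sgn (suc k) = - sgn k

risingℤ : ℤ → ℕ → ℤ
risingℤ a zero    = + 1
risingℤ a (suc m) = risingℤ a m ℤ.* (a ℤ.+ + m)

-- coefficient of t^m in (1-t)^(-r), r ∈ ℤ: r^(rising m) / m!
negBinomCoeff : ℤ → ℕ → ℚ
negBinomCoeff r m = (risingℤ r m / (m !)) {{m !≢0}}

-- hyperharmonic number h_n^{(r)}: coefficient of t^n in -ln(1-t)/(1-t)^r,
-- i.e. Σ_{j=1}^{n} (1/j) [t^{n-j}] (1-t)^{-r}   (since -ln(1-t) = Σ_{j≥1} t^j/j)
hyper : ℤ → ℕ → ℚ
hyper r n = Σ₁ n (λ j → (+ 1 / suc (j ∸ 1)) * negBinomCoeff r (n ∸ j))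

harmonic : ℕ → ℚ
harmonic k = Σ₁ k (λ j → + 1 / suc (j ∸ 1))

-- Bernoulli numbers (B₁ = -1/2, matching t/(e^t-1)) via the recurrence
-- Σ_{k=0}^{n} C(n+1,k) B_k = 0 for n ≥ 1, B₀ = 1.
-- bernRev n = B_n ∷ B_{n-1} ∷ … ∷ B_0
private
  weighted : ℕ → List ℚ → ℚ
  weighted m []       = 0ℚ
  weighted m (b ∷ bs) = ℕ→ℚ (m C length bs) * b + weighted m bs

bernRev : ℕ → List ℚ
bernRev zero    = 1ℚ ∷ []
bernRev (suc n) = (- ((+ 1 / suc (suc n)) * weighted (suc (suc n)) (bernRev n))) ∷ bernRev n

bernoulli : ℕ → ℚ
bernoulli n with bernRev n
... | []    = 0ℚ
... | b ∷ _ = b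

-- Bernoulli polynomial B_n(x) = Σ_{k=0}^{n} C(n,k) B_k x^{n-k}
-- (equivalent to the generating function t e^{xt}/(e^t-1))
bernoulliPoly : ℕ → ℚ → ℚ
bernoulliPoly n x = Σ₀ n (λ k → ℕ→ℚ (n C k) * bernoulli k * (x ^ℚ (n ∸ k)))

-- Polynomials over ℕ as coefficient lists (constant term first)
private
  addP : List ℕ → List ℕ → List ℕ
  addP []       q        = q
  addP p        []       = p
  addP (a ∷ p)  (b ∷ q)  = (a ℕ.+ b) ∷ addP p q

  scaleP : ℕ → List ℕ → List ℕ
  scaleP c []      = []
  scaleP c (a ∷ p) = (c ℕ.* a) ∷ scaleP c p

  mulLin : ℕ → List ℕ → List ℕ
  mulLin c p = addP (0 ∷ p) (scaleP c p)

  coeff : List ℕ → ℕ → ℕ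
  coeff []      k       = 0
  coeff (a ∷ p) zero    = a
  coeff (a ∷ p) (suc k) = coeff p k

risingPoly : ℕ → ℕ → List ℕ
risingPoly m zero    = 1 ∷ []
risingPoly m (suc n) = mulLin (m ℕ.+ n) (risingPoly m n)

rStirling₁ : ℕ → ℕ → ℕ → ℕ
rStirling₁ n k m = coeff (risingPoly m n) k

-- Both identities are statements about the convolution
-- c_N(A, B) = Σ_{k=1}^{N} h_k^(A) h_{N+1-k}^(B).  The Pascal rule
-- h_{k+1}^(R+1) = h_k^(R+1) + h_{k+1}^(R) moves one unit of upper index from one
-- factor to the other, so c_N(r, s) = c_N(r + s, 0), and the left side of the second
-- identity is c_n(r - 1, r) = c_n(2r - 1, 0).
--
-- For the first identity, c_n(a, 0) and the binomial sum on the right obey the same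
-- Pascal recursion in (n, a), and at a = 0 both equal 2 H_n / (n + 1): on the left by
-- partial fractions, on the right by alternating binomial sums of 1/(k+1) and of H_k.
--
-- For the second, let L_y be the functional x^j ↦ (-1)^(j+1) j B_{j-1}(y) on
-- polynomials, so that Σ_k [n k]_m (-1)^(k+1) k B_{k-1}(y) = L_y((x + m)^(rising n)).
-- The addition formula gives L_y(p(x)) = L_{y+1}(p(x + 1)), and
-- B_j(y + 1) - B_j(y) = j y^(j-1) gives L_y = L_{y+1} + (second derivative at -y).
-- Applied to (x + M)^(rising N+1), these two facts yield
-- (N + 1) L_y((x + M)^(rising N)) = ∂²_s s^(rising N+1) at s = M - y.
-- Finally (N + 1)! c_N(c, 0) is that same second derivative at s = c, as both sides
-- satisfy the same recursions in N and c; here c = m - y = 2r - 1.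

module Submission where

open import Defs
open import Data.Nat using (ℕ; suc; _!)
open import Data.Nat.Properties using (_!≢0)
open import Data.Nat.Combinatorics using (_C_)
open import Data.Integer using (+_; _-_)
open import Data.Rational using (ℚ; _/_; _+_; _*_)
open import Data.Product using (_×_)
open import Relation.Binary.PropositionalEquality using (_≡_)

open import Level using (0ℓ)
open import Data.Nat as ℕ using (zero; _∸_; z≤n; s≤s)
import Data.Nat.Properties as ℕP
open import Data.Nat.Combinatorics
  using (nCk+nC[k+1]≡[n+1]C[k+1]; nCk≡n!/k![n-k]!; k>n⇒nCk≡0; k![n∸k]!∣n!; nCn≡1; nC1≡n; nCk≡nC[n∸k])
open import Data.Nat.DivMod using (m/n*n≡m)
open import Data.Nat.Tactic.RingSolver using () renaming (solve-∀ to ℕ-solve-∀)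
open import Data.Integer as ℤ using (ℤ; -[1+_])
import Data.Integer.Properties as ℤP
open import Data.Rational using (0ℚ; 1ℚ; -_; toℚᵘ)
open import Data.Rational.Properties
open import Algebra.Properties.Group +-0-group using () renaming (∙-cancelʳ to +-cancelʳ; ⁻¹-involutive to neg-involutive)
import Data.Rational.Unnormalised as U
import Data.Rational.Unnormalised.Properties as UP
open import Data.Product using (_,_)
open import Data.List using (List; []; _∷_; length)
open import Relation.Nullary using (yes; no)
open import Relation.Nullary.Decidable using (dec⇒maybe)
open import Relation.Binary.PropositionalEquality using (refl; sym; trans; cong; cong₂; subst; module ≡-Reasoning)
open import Tactic.RingSolver.Core.AlmostCommutativeRing using (AlmostCommutativeRing; fromCommutativeRing)
open import Tactic.RingSolver using (solve-∀)
open ≡-Reasoning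

-- Rational arithmetic

ℚ-ring : AlmostCommutativeRing 0ℓ 0ℓ
ℚ-ring = fromCommutativeRing +-*-commutativeRing (λ x → dec⇒maybe (0ℚ ≟ x))

-- Equalities of rationals built with _/_ are checked on their unnormalised
-- representatives, where they become equations between integers.
toℚᵘ-/ : ∀ z d → toℚᵘ (z / suc d) U.≃ U.mkℚᵘ z d
toℚᵘ-/ z d = toℚᵘ-fromℚᵘ (U.mkℚᵘ z d)

≡-via-toℚᵘ : ∀ {p q : ℚ} {u v : U.ℚᵘ} → toℚᵘ p U.≃ u → toℚᵘ q U.≃ v → u U.≃ v → p ≡ q
≡-via-toℚᵘ p≃u q≃v u≃v = toℚᵘ-injective (UP.≃-trans p≃u (UP.≃-trans u≃v (UP.≃-sym q≃v)))

ℤ→ℚ-homo-+ : ∀ a b → ℤ→ℚ (a ℤ.+ b) ≡ ℤ→ℚ a + ℤ→ℚ b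
ℤ→ℚ-homo-+ a b = ≡-via-toℚᵘ (toℚᵘ-/ (a ℤ.+ b) 0)
  (UP.≃-trans (toℚᵘ-homo-+ (ℤ→ℚ a) (ℤ→ℚ b)) (UP.+-cong (toℚᵘ-/ a 0) (toℚᵘ-/ b 0)))
  (U.*≡* (cong₂ ℤ._*_ (sym (cong₂ ℤ._+_ (ℤP.*-identityʳ a) (ℤP.*-identityʳ b))) refl))

ℤ→ℚ-homo-* : ∀ a b → ℤ→ℚ (a ℤ.* b) ≡ ℤ→ℚ a * ℤ→ℚ b
ℤ→ℚ-homo-* a b = ≡-via-toℚᵘ (toℚᵘ-/ (a ℤ.* b) 0)
  (UP.≃-trans (toℚᵘ-homo-* (ℤ→ℚ a) (ℤ→ℚ b)) (UP.*-cong (toℚᵘ-/ a 0) (toℚᵘ-/ b 0)))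
  (U.*≡* refl)

ℤ→ℚ-homo-neg : ∀ a → ℤ→ℚ (ℤ.- a) ≡ - ℤ→ℚ a
ℤ→ℚ-homo-neg a = ≡-via-toℚᵘ (toℚᵘ-/ (ℤ.- a) 0)
  (UP.≃-trans (toℚᵘ-homo‿- (ℤ→ℚ a)) (UP.-‿cong (toℚᵘ-/ a 0)))
  (U.*≡* refl)

ℤ→ℚ-suc : ∀ a → ℤ→ℚ (ℤ.suc a) ≡ ℤ→ℚ a + 1ℚ
ℤ→ℚ-suc a = trans (ℤ→ℚ-homo-+ (+ 1) a) (+-comm 1ℚ (ℤ→ℚ a))

ℕ→ℚ-homo-+ : ∀ a b → ℕ→ℚ (a ℕ.+ b) ≡ ℕ→ℚ a + ℕ→ℚ b
ℕ→ℚ-homo-+ a b = trans (cong ℤ→ℚ (ℤP.pos-+ a b)) (ℤ→ℚ-homo-+ (+ a) (+ b))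

ℕ→ℚ-homo-* : ∀ a b → ℕ→ℚ (a ℕ.* b) ≡ ℕ→ℚ a * ℕ→ℚ b
ℕ→ℚ-homo-* a b = trans (cong ℤ→ℚ (ℤP.pos-* a b)) (ℤ→ℚ-homo-* (+ a) (+ b))

ℕ→ℚ-suc : ∀ n → ℕ→ℚ (suc n) ≡ 1ℚ + ℕ→ℚ n
ℕ→ℚ-suc = ℕ→ℚ-homo-+ 1

n*[z/n]≡z : ∀ z d .{{_ : ℕ.NonZero d}} → ℕ→ℚ d * (z / d) ≡ ℤ→ℚ z
n*[z/n]≡z z (suc d) = ≡-via-toℚᵘ
  (UP.≃-trans (toℚᵘ-homo-* (ℕ→ℚ (suc d)) (z / suc d)) (UP.*-cong (toℚᵘ-/ (+ suc d) 0) (toℚᵘ-/ z d)))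
  (toℚᵘ-/ z 0)
  (U.*≡* (trans (ℤP.*-identityʳ (+ suc d ℤ.* z))
    (trans (ℤP.*-comm (+ suc d) z) (cong (λ n → z ℤ.* + n) (sym (ℕP.+-identityʳ (suc d)))))))

n*[1/n]≡1 : ∀ d .{{_ : ℕ.NonZero d}} → ℕ→ℚ d * (+ 1 / d) ≡ 1ℚ
n*[1/n]≡1 = n*[z/n]≡z (+ 1)

[1/n]*n≡1 : ∀ d .{{_ : ℕ.NonZero d}} → (+ 1 / d) * ℕ→ℚ d ≡ 1ℚ
[1/n]*n≡1 d = trans (*-comm (+ 1 / d) (ℕ→ℚ d)) (n*[1/n]≡1 d)

[1/n]*[n*x]≡x : ∀ d .{{_ : ℕ.NonZero d}} x → (+ 1 / d) * (ℕ→ℚ d * x) ≡ x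
[1/n]*[n*x]≡x d x = trans (sym (*-assoc (+ 1 / d) (ℕ→ℚ d) x)) (trans (cong (_* x) ([1/n]*n≡1 d)) (*-identityˡ x))

ℕ→ℚ-*-cancelˡ : ∀ d .{{_ : ℕ.NonZero d}} {x y} → ℕ→ℚ d * x ≡ ℕ→ℚ d * y → x ≡ y
ℕ→ℚ-*-cancelˡ d {x} {y} dx≡dy = begin
  x                         ≡⟨ [1/n]*[n*x]≡x d x ⟨
  (+ 1 / d) * (ℕ→ℚ d * x)   ≡⟨ cong ((+ 1 / d) *_) dx≡dy ⟩
  (+ 1 / d) * (ℕ→ℚ d * y)   ≡⟨ [1/n]*[n*x]≡x d y ⟩
  y                         ∎

-- Finite sums

Σ₁-cong-< : ∀ n {f g : ℕ → ℚ} → (∀ k → k ℕ.< n → f (suc k) ≡ g (suc k)) → Σ₁ n f ≡ Σ₁ n g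
Σ₁-cong-< zero    f≡g = refl
Σ₁-cong-< (suc n) f≡g = cong₂ _+_ (Σ₁-cong-< n (λ k k<n → f≡g k (ℕP.m<n⇒m<1+n k<n))) (f≡g n (ℕP.n<1+n n))

Σ₀-cong-≤ : ∀ n {f g : ℕ → ℚ} → (∀ k → k ℕ.≤ n → f k ≡ g k) → Σ₀ n f ≡ Σ₀ n g
Σ₀-cong-≤ zero    f≡g = f≡g 0 z≤n
Σ₀-cong-≤ (suc n) f≡g = cong₂ _+_ (Σ₀-cong-≤ n (λ k k≤n → f≡g k (ℕP.m≤n⇒m≤1+n k≤n))) (f≡g (suc n) ℕP.≤-refl)

Σ₁-cong : ∀ n {f g : ℕ → ℚ} → (∀ k → f k ≡ g k) → Σ₁ n f ≡ Σ₁ n g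
Σ₁-cong n f≡g = Σ₁-cong-< n (λ k _ → f≡g (suc k))

Σ₀-cong : ∀ n {f g : ℕ → ℚ} → (∀ k → f k ≡ g k) → Σ₀ n f ≡ Σ₀ n g
Σ₀-cong n f≡g = Σ₀-cong-≤ n (λ k _ → f≡g k)

private
  interchange : ∀ a b c d → (a + b) + (c + d) ≡ (a + c) + (b + d)
  interchange = solve-∀ ℚ-ring

Σ₁-distrib-+ : ∀ n (f g : ℕ → ℚ) → Σ₁ n (λ k → f k + g k) ≡ Σ₁ n f + Σ₁ n g
Σ₁-distrib-+ zero    f g = sym (+-identityˡ 0ℚ)
Σ₁-distrib-+ (suc n) f g =
  trans (cong (_+ (f (suc n) + g (suc n))) (Σ₁-distrib-+ n f g)) (interchange (Σ₁ n f) (Σ₁ n g) (f (suc n)) (g (suc n)))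

Σ₀-distrib-+ : ∀ n (f g : ℕ → ℚ) → Σ₀ n (λ k → f k + g k) ≡ Σ₀ n f + Σ₀ n g
Σ₀-distrib-+ zero    f g = refl
Σ₀-distrib-+ (suc n) f g =
  trans (cong (_+ (f (suc n) + g (suc n))) (Σ₀-distrib-+ n f g)) (interchange (Σ₀ n f) (Σ₀ n g) (f (suc n)) (g (suc n)))

Σ₁-*-distribˡ : ∀ n c (f : ℕ → ℚ) → Σ₁ n (λ k → c * f k) ≡ c * Σ₁ n f
Σ₁-*-distribˡ zero    c f = sym (*-zeroʳ c)
Σ₁-*-distribˡ (suc n) c f =
  trans (cong (_+ (c * f (suc n))) (Σ₁-*-distribˡ n c f)) (sym (*-distribˡ-+ c (Σ₁ n f) (f (suc n))))

Σ₀-*-distribˡ : ∀ n c (f : ℕ → ℚ) → Σ₀ n (λ k → c * f k) ≡ c * Σ₀ n f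
Σ₀-*-distribˡ zero    c f = refl
Σ₀-*-distribˡ (suc n) c f =
  trans (cong (_+ (c * f (suc n))) (Σ₀-*-distribˡ n c f)) (sym (*-distribˡ-+ c (Σ₀ n f) (f (suc n))))

Σ₁-zero : ∀ n → Σ₁ n (λ _ → 0ℚ) ≡ 0ℚ
Σ₁-zero zero    = refl
Σ₁-zero (suc n) = trans (+-identityʳ (Σ₁ n (λ _ → 0ℚ))) (Σ₁-zero n)

Σ₀-zero : ∀ n → Σ₀ n (λ _ → 0ℚ) ≡ 0ℚ
Σ₀-zero zero    = refl
Σ₀-zero (suc n) = trans (+-identityʳ (Σ₀ n (λ _ → 0ℚ))) (Σ₀-zero n)

Σ₀-neg : ∀ n (f : ℕ → ℚ) → Σ₀ n (λ k → - f k) ≡ - Σ₀ n f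
Σ₀-neg zero    f = refl
Σ₀-neg (suc n) f = trans (cong (_+ (- f (suc n))) (Σ₀-neg n f)) (sym (neg-distrib-+ (Σ₀ n f) (f (suc n))))

Σ₁-unfoldˡ : ∀ n (f : ℕ → ℚ) → Σ₁ (suc n) f ≡ f 1 + Σ₁ n (λ k → f (suc k))
Σ₁-unfoldˡ zero    f = trans (+-identityˡ (f 1)) (sym (+-identityʳ (f 1)))
Σ₁-unfoldˡ (suc n) f =
  trans (cong (_+ f (suc (suc n))) (Σ₁-unfoldˡ n f)) (+-assoc (f 1) (Σ₁ n (λ k → f (suc k))) (f (suc (suc n))))

Σ₀-unfoldˡ : ∀ n (f : ℕ → ℚ) → Σ₀ (suc n) f ≡ f 0 + Σ₀ n (λ k → f (suc k))
Σ₀-unfoldˡ zero    f = refl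
Σ₀-unfoldˡ (suc n) f =
  trans (cong (_+ f (suc (suc n))) (Σ₀-unfoldˡ n f)) (+-assoc (f 0) (Σ₀ n (λ k → f (suc k))) (f (suc (suc n))))

Σ₀-suc≡Σ₁ : ∀ n (f : ℕ → ℚ) → Σ₀ n (λ k → f (suc k)) ≡ Σ₁ (suc n) f
Σ₀-suc≡Σ₁ zero    f = sym (+-identityˡ (f 1))
Σ₀-suc≡Σ₁ (suc n) f = cong (_+ f (suc (suc n))) (Σ₀-suc≡Σ₁ n f)

Σ₀≡f0+Σ₁ : ∀ n (f : ℕ → ℚ) → Σ₀ n f ≡ f 0 + Σ₁ n f
Σ₀≡f0+Σ₁ zero    f = sym (+-identityʳ (f 0))
Σ₀≡f0+Σ₁ (suc n) f = trans (cong (_+ f (suc n)) (Σ₀≡f0+Σ₁ n f)) (+-assoc (f 0) (Σ₁ n f) (f (suc n)))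

Σ₁-reverse : ∀ n (f : ℕ → ℚ) → Σ₁ n f ≡ Σ₁ n (λ k → f (suc n ∸ k))
Σ₁-reverse zero    f = refl
Σ₁-reverse (suc n) f = begin
  Σ₁ n f + f (suc n)                       ≡⟨ cong (_+ f (suc n)) (Σ₁-reverse n f) ⟩
  Σ₁ n (λ k → f (suc n ∸ k)) + f (suc n)   ≡⟨ +-comm (Σ₁ n (λ k → f (suc n ∸ k))) (f (suc n)) ⟩
  f (suc n) + Σ₁ n (λ k → f (suc n ∸ k))   ≡⟨ Σ₁-unfoldˡ n (λ k → f (suc (suc n) ∸ k)) ⟨
  Σ₁ (suc n) (λ k → f (suc (suc n) ∸ k))   ∎

Σ₀-triangle-swap : ∀ n (F : ℕ → ℕ → ℚ) →
  Σ₀ n (λ j → Σ₀ j (F j)) ≡ Σ₀ n (λ k → Σ₀ (n ∸ k) (λ i → F (k ℕ.+ i) k))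
Σ₀-triangle-swap zero    F = refl
Σ₀-triangle-swap (suc n) F = begin
  Σ₀ n (λ j → Σ₀ j (F j)) + (Σ₀ n (F (suc n)) + F (suc n) (suc n))
    ≡⟨ cong (_+ (Σ₀ n (F (suc n)) + F (suc n) (suc n))) (Σ₀-triangle-swap n F) ⟩
  Σ₀ n column + (Σ₀ n (F (suc n)) + F (suc n) (suc n))
    ≡⟨ +-assoc (Σ₀ n column) (Σ₀ n (F (suc n))) (F (suc n) (suc n)) ⟨
  (Σ₀ n column + Σ₀ n (F (suc n))) + F (suc n) (suc n)
    ≡⟨ cong (_+ F (suc n) (suc n)) (Σ₀-distrib-+ n column (F (suc n))) ⟨
  Σ₀ n (λ k → column k + F (suc n) k) + F (suc n) (suc n)
    ≡⟨ cong₂ _+_ (Σ₀-cong-≤ n extend) corner ⟩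
  Σ₀ (suc n) (λ k → Σ₀ (suc n ∸ k) (λ i → F (k ℕ.+ i) k)) ∎
  where
  column : ℕ → ℚ
  column k = Σ₀ (n ∸ k) (λ i → F (k ℕ.+ i) k)
  corner : F (suc n) (suc n) ≡ Σ₀ (suc n ∸ suc n) (λ i → F (suc n ℕ.+ i) (suc n))
  corner rewrite ℕP.n∸n≡0 n = cong (λ t → F t (suc n)) (sym (ℕP.+-identityʳ (suc n)))
  extend : ∀ k → k ℕ.≤ n → column k + F (suc n) k ≡ Σ₀ (suc n ∸ k) (λ i → F (k ℕ.+ i) k)
  extend k k≤n rewrite ℕP.+-∸-assoc 1 k≤n =
    cong (λ t → column k + F t k) (sym (trans (ℕP.+-suc k (n ∸ k)) (cong suc (ℕP.m+[n∸m]≡n k≤n))))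

-- Binomial coefficients, powers and signs

C-pascal : ∀ n k → suc n C suc k ≡ n C k ℕ.+ n C suc k
C-pascal n k = sym (nCk+nC[k+1]≡[n+1]C[k+1] n k)

[1+n]Cn≡1+n : ∀ n → suc n C n ≡ suc n
[1+n]Cn≡1+n n = begin
  suc n C n             ≡⟨ nCk≡nC[n∸k] (ℕP.n≤1+n n) ⟩
  suc n C (suc n ∸ n)   ≡⟨ cong (suc n C_) (ℕP.m+n∸n≡m 1 n) ⟩
  suc n C 1             ≡⟨ nC1≡n (suc n) ⟩
  suc n                 ∎

[1+k]*[1+n]C[1+k]≡[1+n]*nCk : ∀ n k → suc k ℕ.* (suc n C suc k) ≡ suc n ℕ.* (n C k)
[1+k]*[1+n]C[1+k]≡[1+n]*nCk n       zero    = trans (ℕP.+-identityʳ (suc n C 1)) (trans (nC1≡n (suc n)) (sym (ℕP.*-identityʳ (suc n))))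
[1+k]*[1+n]C[1+k]≡[1+n]*nCk zero    (suc k) = ℕP.*-zeroʳ (suc (suc k))
[1+k]*[1+n]C[1+k]≡[1+n]*nCk (suc n) (suc k) = begin
  suc (suc k) ℕ.* (suc (suc n) C suc (suc k))
    ≡⟨ cong (suc (suc k) ℕ.*_) (C-pascal (suc n) (suc k)) ⟩
  suc (suc k) ℕ.* (suc n C suc k ℕ.+ suc n C suc (suc k))
    ≡⟨ regroup (suc n C suc k) (suc n C suc (suc k)) k ⟩
  suc n C suc k ℕ.+ suc k ℕ.* (suc n C suc k) ℕ.+ suc (suc k) ℕ.* (suc n C suc (suc k))
    ≡⟨ cong₂ (λ a b → suc n C suc k ℕ.+ a ℕ.+ b) ([1+k]*[1+n]C[1+k]≡[1+n]*nCk n k) ([1+k]*[1+n]C[1+k]≡[1+n]*nCk n (suc k)) ⟩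
  suc n C suc k ℕ.+ suc n ℕ.* (n C k) ℕ.+ suc n ℕ.* (n C suc k)
    ≡⟨ regroup′ (suc n C suc k) (n C k) (n C suc k) n ⟩
  suc n C suc k ℕ.+ suc n ℕ.* (n C k ℕ.+ n C suc k)
    ≡⟨ cong (λ t → suc n C suc k ℕ.+ suc n ℕ.* t) (C-pascal n k) ⟨
  suc (suc n) ℕ.* (suc n C suc k) ∎
  where
  regroup : ∀ a b k → suc (suc k) ℕ.* (a ℕ.+ b) ≡ a ℕ.+ suc k ℕ.* a ℕ.+ suc (suc k) ℕ.* b
  regroup = ℕ-solve-∀
  regroup′ : ∀ a b c n → a ℕ.+ suc n ℕ.* b ℕ.+ suc n ℕ.* c ≡ a ℕ.+ suc n ℕ.* (b ℕ.+ c)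
  regroup′ = ℕ-solve-∀

nCk*k![n∸k]!≡n! : ∀ {n k} → k ℕ.≤ n → (n C k) ℕ.* (k ! ℕ.* (n ∸ k) !) ≡ n !
nCk*k![n∸k]!≡n! {n} {k} k≤n =
  trans (cong (ℕ._* (k ! ℕ.* (n ∸ k) !)) (nCk≡n!/k![n-k]! k≤n)) (m/n*n≡m (k![n∸k]!∣n! k≤n))
  where instance _ = ℕP._!*_!≢0 k (n ∸ k)

nC[k+i]*[k+i]Ck≡nCk*[n∸k]Ci : ∀ n k i → (n C (k ℕ.+ i)) ℕ.* ((k ℕ.+ i) C k) ≡ (n C k) ℕ.* ((n ∸ k) C i)
nC[k+i]*[k+i]Ck≡nCk*[n∸k]Ci n k i with k ℕ.+ i ℕ.≤? n
... | no k+i≰n = trans (cong (ℕ._* ((k ℕ.+ i) C k)) (k>n⇒nCk≡0 (ℕP.≰⇒> k+i≰n))) (sym right-vanishes)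
  where
  right-vanishes : (n C k) ℕ.* ((n ∸ k) C i) ≡ 0
  right-vanishes with k ℕ.≤? n
  ... | yes k≤n = trans (cong ((n C k) ℕ.*_) (k>n⇒nCk≡0 (ℕP.+-cancelˡ-< k (n ∸ k) i
                    (subst (ℕ._< k ℕ.+ i) (sym (ℕP.m+[n∸m]≡n k≤n)) (ℕP.≰⇒> k+i≰n)))))
                    (ℕP.*-zeroʳ (n C k))
  ... | no k≰n  = cong (ℕ._* ((n ∸ k) C i)) (k>n⇒nCk≡0 (ℕP.≰⇒> k≰n))
... | yes k+i≤n = ℕP.*-cancelʳ-≡ _ _ (k ! ℕ.* i ! ℕ.* r !) {{nonZero}} (trans left (sym right))
  where
  r = n ∸ (k ℕ.+ i)
  k≤n : k ℕ.≤ n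
  k≤n = ℕP.≤-trans (ℕP.m≤m+n k i) k+i≤n
  i≤n∸k : i ℕ.≤ n ∸ k
  i≤n∸k = ℕP.+-cancelˡ-≤ k i (n ∸ k) (subst (k ℕ.+ i ℕ.≤_) (sym (ℕP.m+[n∸m]≡n k≤n)) k+i≤n)
  nonZero : ℕ.NonZero (k ! ℕ.* i ! ℕ.* r !)
  nonZero = ℕP.m*n≢0 (k ! ℕ.* i !) (r !) {{ℕP._!*_!≢0 k i}} {{r !≢0}}
  left : (n C (k ℕ.+ i)) ℕ.* ((k ℕ.+ i) C k) ℕ.* (k ! ℕ.* i ! ℕ.* r !) ≡ n !
  left = begin
    (n C (k ℕ.+ i)) ℕ.* ((k ℕ.+ i) C k) ℕ.* (k ! ℕ.* i ! ℕ.* r !)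
      ≡⟨ regroup (n C (k ℕ.+ i)) ((k ℕ.+ i) C k) (k !) (i !) (r !) ⟩
    (n C (k ℕ.+ i)) ℕ.* (((k ℕ.+ i) C k) ℕ.* (k ! ℕ.* i !)) ℕ.* r !
      ≡⟨ cong (λ t → (n C (k ℕ.+ i)) ℕ.* (((k ℕ.+ i) C k) ℕ.* (k ! ℕ.* t !)) ℕ.* r !) (ℕP.m+n∸m≡n k i) ⟨
    (n C (k ℕ.+ i)) ℕ.* (((k ℕ.+ i) C k) ℕ.* (k ! ℕ.* (k ℕ.+ i ∸ k) !)) ℕ.* r !
      ≡⟨ cong (λ t → (n C (k ℕ.+ i)) ℕ.* t ℕ.* r !) (nCk*k![n∸k]!≡n! (ℕP.m≤m+n k i)) ⟩
    (n C (k ℕ.+ i)) ℕ.* (k ℕ.+ i) ! ℕ.* r !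
      ≡⟨ ℕP.*-assoc (n C (k ℕ.+ i)) ((k ℕ.+ i) !) (r !) ⟩
    (n C (k ℕ.+ i)) ℕ.* ((k ℕ.+ i) ! ℕ.* r !)
      ≡⟨ nCk*k![n∸k]!≡n! k+i≤n ⟩
    n ! ∎
    where
    regroup : ∀ a b x y z → a ℕ.* b ℕ.* (x ℕ.* y ℕ.* z) ≡ a ℕ.* (b ℕ.* (x ℕ.* y)) ℕ.* z
    regroup = ℕ-solve-∀
  right : (n C k) ℕ.* ((n ∸ k) C i) ℕ.* (k ! ℕ.* i ! ℕ.* r !) ≡ n !
  right = begin
    (n C k) ℕ.* ((n ∸ k) C i) ℕ.* (k ! ℕ.* i ! ℕ.* r !)
      ≡⟨ regroup (n C k) ((n ∸ k) C i) (k !) (i !) (r !) ⟩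
    (n C k) ℕ.* (k ! ℕ.* (((n ∸ k) C i) ℕ.* (i ! ℕ.* r !)))
      ≡⟨ cong (λ t → (n C k) ℕ.* (k ! ℕ.* (((n ∸ k) C i) ℕ.* (i ! ℕ.* t !)))) (ℕP.∸-+-assoc n k i) ⟨
    (n C k) ℕ.* (k ! ℕ.* (((n ∸ k) C i) ℕ.* (i ! ℕ.* (n ∸ k ∸ i) !)))
      ≡⟨ cong (λ t → (n C k) ℕ.* (k ! ℕ.* t)) (nCk*k![n∸k]!≡n! i≤n∸k) ⟩
    (n C k) ℕ.* (k ! ℕ.* (n ∸ k) !)
      ≡⟨ nCk*k![n∸k]!≡n! k≤n ⟩
    n ! ∎
    where
    regroup : ∀ a b x y z → a ℕ.* b ℕ.* (x ℕ.* y ℕ.* z) ≡ a ℕ.* (x ℕ.* (b ℕ.* (y ℕ.* z)))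
    regroup = ℕ-solve-∀

C[_,_] : ℕ → ℕ → ℚ
C[ n , k ] = ℕ→ℚ (n C k)

C[]-pascal : ∀ n k → C[ suc n , suc k ] ≡ C[ n , k ] + C[ n , suc k ]
C[]-pascal n k = trans (cong ℕ→ℚ (C-pascal n k)) (ℕ→ℚ-homo-+ (n C k) (n C suc k))

C[]-vanish : ∀ {n k} → n ℕ.< k → C[ n , k ] ≡ 0ℚ
C[]-vanish n<k = cong ℕ→ℚ (k>n⇒nCk≡0 n<k)

C[]-absorb : ∀ n k → ℕ→ℚ (suc k) * C[ suc n , suc k ] ≡ ℕ→ℚ (suc n) * C[ n , k ]
C[]-absorb n k = trans (sym (ℕ→ℚ-homo-* (suc k) (suc n C suc k)))
  (trans (cong ℕ→ℚ ([1+k]*[1+n]C[1+k]≡[1+n]*nCk n k)) (ℕ→ℚ-homo-* (suc n) (n C k)))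

C[]-absorb-inverse : ∀ n k → C[ n , k ] * (+ 1 / suc k) ≡ (+ 1 / suc n) * C[ suc n , suc k ]
C[]-absorb-inverse n k = ℕ→ℚ-*-cancelˡ (suc n) (begin
  ℕ→ℚ (suc n) * (C[ n , k ] * (+ 1 / suc k))                           ≡⟨ *-assoc (ℕ→ℚ (suc n)) _ _ ⟨
  ℕ→ℚ (suc n) * C[ n , k ] * (+ 1 / suc k)                             ≡⟨ cong (_* (+ 1 / suc k)) (C[]-absorb n k) ⟨
  ℕ→ℚ (suc k) * C[ suc n , suc k ] * (+ 1 / suc k)                     ≡⟨ swap (ℕ→ℚ (suc k)) C[ suc n , suc k ] (+ 1 / suc k) ⟩
  C[ suc n , suc k ] * (ℕ→ℚ (suc k) * (+ 1 / suc k))                   ≡⟨ cong (C[ suc n , suc k ] *_) (n*[1/n]≡1 (suc k)) ⟩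
  C[ suc n , suc k ] * 1ℚ                                              ≡⟨ cong (C[ suc n , suc k ] *_) (n*[1/n]≡1 (suc n)) ⟨
  C[ suc n , suc k ] * (ℕ→ℚ (suc n) * (+ 1 / suc n))                   ≡⟨ swap′ C[ suc n , suc k ] (ℕ→ℚ (suc n)) (+ 1 / suc n) ⟩
  ℕ→ℚ (suc n) * ((+ 1 / suc n) * C[ suc n , suc k ])                   ∎)
  where
  swap : ∀ a b c → a * b * c ≡ b * (a * c)
  swap = solve-∀ ℚ-ring
  swap′ : ∀ a b c → a * (b * c) ≡ b * (c * a)
  swap′ = solve-∀ ℚ-ring

C[]-trinomial : ∀ n k i → C[ n , k ℕ.+ i ] * C[ k ℕ.+ i , k ] ≡ C[ n , k ] * C[ n ∸ k , i ]
C[]-trinomial n k i = trans (sym (ℕ→ℚ-homo-* (n C (k ℕ.+ i)) ((k ℕ.+ i) C k)))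
  (trans (cong ℕ→ℚ (nC[k+i]*[k+i]Ck≡nCk*[n∸k]Ci n k i)) (ℕ→ℚ-homo-* (n C k) ((n ∸ k) C i)))

Σ₀-pascal : ∀ i (G : ℕ → ℚ) →
  Σ₀ (suc i) (λ l → C[ suc i , l ] * G l) ≡ Σ₀ i (λ l → C[ i , l ] * G l) + Σ₀ i (λ l → C[ i , l ] * G (suc l))
Σ₀-pascal i G = begin
  Σ₀ (suc i) (λ l → C[ suc i , l ] * G l)
    ≡⟨ Σ₀-unfoldˡ i (λ l → C[ suc i , l ] * G l) ⟩
  1ℚ * G 0 + Σ₀ i (λ l → C[ suc i , suc l ] * G (suc l))
    ≡⟨ cong (λ t → 1ℚ * G 0 + t) (Σ₀-cong i split) ⟩
  1ℚ * G 0 + Σ₀ i (λ l → C[ i , l ] * G (suc l) + C[ i , suc l ] * G (suc l))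
    ≡⟨ cong (λ t → 1ℚ * G 0 + t) (Σ₀-distrib-+ i (λ l → C[ i , l ] * G (suc l)) (λ l → C[ i , suc l ] * G (suc l))) ⟩
  1ℚ * G 0 + (shifted + Σ₀ i (λ l → C[ i , suc l ] * G (suc l)))
    ≡⟨ cong (λ t → 1ℚ * G 0 + (shifted + t)) (Σ₀-suc≡Σ₁ i (λ l → C[ i , l ] * G l)) ⟩
  1ℚ * G 0 + (shifted + (Σ₁ i (λ l → C[ i , l ] * G l) + C[ i , suc i ] * G (suc i)))
    ≡⟨ cong (λ t → 1ℚ * G 0 + (shifted + (Σ₁ i (λ l → C[ i , l ] * G l) + t * G (suc i)))) (C[]-vanish (ℕP.n<1+n i)) ⟩
  1ℚ * G 0 + (shifted + (Σ₁ i (λ l → C[ i , l ] * G l) + 0ℚ * G (suc i)))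
    ≡⟨ rearrange (G 0) shifted (Σ₁ i (λ l → C[ i , l ] * G l)) (G (suc i)) ⟩
  (1ℚ * G 0 + Σ₁ i (λ l → C[ i , l ] * G l)) + shifted
    ≡⟨ cong (_+ shifted) (Σ₀≡f0+Σ₁ i (λ l → C[ i , l ] * G l)) ⟨
  Σ₀ i (λ l → C[ i , l ] * G l) + shifted ∎
  where
  shifted = Σ₀ i (λ l → C[ i , l ] * G (suc l))
  split : ∀ l → C[ suc i , suc l ] * G (suc l) ≡ C[ i , l ] * G (suc l) + C[ i , suc l ] * G (suc l)
  split l = trans (cong (_* G (suc l)) (C[]-pascal i l)) (*-distribʳ-+ (G (suc l)) C[ i , l ] C[ i , suc l ])
  rearrange : ∀ a b c d → 1ℚ * a + (b + (c + 0ℚ * d)) ≡ (1ℚ * a + c) + b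
  rearrange = solve-∀ ℚ-ring

1^n≡1 : ∀ n → 1ℚ ^ℚ n ≡ 1ℚ
1^n≡1 zero    = refl
1^n≡1 (suc n) = trans (*-identityˡ (1ℚ ^ℚ n)) (1^n≡1 n)

0^[1+n]≡0 : ∀ n → 0ℚ ^ℚ suc n ≡ 0ℚ
0^[1+n]≡0 n = *-zeroˡ (0ℚ ^ℚ n)

sgn-suc-suc : ∀ j → sgn (suc (suc j)) ≡ sgn j
sgn-suc-suc j = neg-involutive (sgn j)

[-y]^n≡sgn*y^n : ∀ y n → (- y) ^ℚ n ≡ sgn n * y ^ℚ n
[-y]^n≡sgn*y^n y zero    = sym (*-identityˡ 1ℚ)
[-y]^n≡sgn*y^n y (suc n) = trans (cong ((- y) *_) ([-y]^n≡sgn*y^n y n)) (move (sgn n) y (y ^ℚ n))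
  where
  move : ∀ s y p → (- y) * (s * p) ≡ (- s) * (y * p)
  move = solve-∀ ℚ-ring

[-1]^n≡sgn : ∀ n → (- 1ℚ) ^ℚ n ≡ sgn n
[-1]^n≡sgn n = trans ([-y]^n≡sgn*y^n 1ℚ n) (trans (cong (sgn n *_) (1^n≡1 n)) (*-identityʳ (sgn n)))

sgn-+ : ∀ a b → sgn (a ℕ.+ b) ≡ sgn a * sgn b
sgn-+ zero    b = sym (*-identityˡ (sgn b))
sgn-+ (suc a) b = trans (cong -_ (sgn-+ a b)) (neg-distribˡ-* (sgn a) (sgn b))

sgn*sgn≡1 : ∀ n → sgn n * sgn n ≡ 1ℚ
sgn*sgn≡1 zero    = refl
sgn*sgn≡1 (suc n) = trans (negate-both (sgn n)) (sgn*sgn≡1 n)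
  where
  negate-both : ∀ s → (- s) * (- s) ≡ s * s
  negate-both = solve-∀ ℚ-ring

sgn-∸ : ∀ {n j} → j ℕ.≤ n → sgn n * sgn (n ∸ j) ≡ sgn j
sgn-∸ {n} {j} j≤n = begin
  sgn n * sgn (n ∸ j)                   ≡⟨ cong (λ t → sgn t * sgn (n ∸ j)) (ℕP.m+[n∸m]≡n j≤n) ⟨
  sgn (j ℕ.+ (n ∸ j)) * sgn (n ∸ j)     ≡⟨ cong (_* sgn (n ∸ j)) (sgn-+ j (n ∸ j)) ⟩
  sgn j * sgn (n ∸ j) * sgn (n ∸ j)     ≡⟨ *-assoc (sgn j) _ _ ⟩
  sgn j * (sgn (n ∸ j) * sgn (n ∸ j))   ≡⟨ cong (sgn j *_) (sgn*sgn≡1 (n ∸ j)) ⟩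
  sgn j * 1ℚ                            ≡⟨ *-identityʳ (sgn j) ⟩
  sgn j                                 ∎

binomial-theorem : ∀ x h m → (x + h) ^ℚ m ≡ Σ₀ m (λ i → C[ m , i ] * (x ^ℚ i * h ^ℚ (m ∸ i)))
binomial-theorem x h zero    = refl
binomial-theorem x h (suc m) = begin
  (x + h) * (x + h) ^ℚ m                                       ≡⟨ cong ((x + h) *_) (binomial-theorem x h m) ⟩
  (x + h) * Σ₀ m term                                          ≡⟨ *-distribʳ-+ (Σ₀ m term) x h ⟩
  x * Σ₀ m term + h * Σ₀ m term                                ≡⟨ +-comm (x * Σ₀ m term) (h * Σ₀ m term) ⟩
  h * Σ₀ m term + x * Σ₀ m term                                ≡⟨ cong₂ _+_ (Σ₀-*-distribˡ m h term) (Σ₀-*-distribˡ m x term) ⟨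
  Σ₀ m (λ i → h * term i) + Σ₀ m (λ i → x * term i)            ≡⟨ cong₂ _+_ (Σ₀-cong-≤ m raise-h) (Σ₀-cong m raise-x) ⟩
  Σ₀ m (λ l → C[ m , l ] * G l) + Σ₀ m (λ l → C[ m , l ] * G (suc l)) ≡⟨ Σ₀-pascal m G ⟨
  Σ₀ (suc m) (λ i → C[ suc m , i ] * G i)                      ∎
  where
  term : ℕ → ℚ
  term i = C[ m , i ] * (x ^ℚ i * h ^ℚ (m ∸ i))
  G : ℕ → ℚ
  G l = x ^ℚ l * h ^ℚ (suc m ∸ l)
  raise-h : ∀ l → l ℕ.≤ m → h * term l ≡ C[ m , l ] * G l
  raise-h l l≤m rewrite ℕP.+-∸-assoc 1 l≤m = move h C[ m , l ] (x ^ℚ l) (h ^ℚ (m ∸ l))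
    where
    move : ∀ a b c d → a * (b * (c * d)) ≡ b * (c * (a * d))
    move = solve-∀ ℚ-ring
  raise-x : ∀ l → x * term l ≡ C[ m , l ] * G (suc l)
  raise-x l = move x C[ m , l ] (x ^ℚ l) (h ^ℚ (m ∸ l))
    where
    move : ∀ a b c d → a * (b * (c * d)) ≡ b * ((a * c) * d)
    move = solve-∀ ℚ-ring

-- Bernoulli numbers and polynomials

weighted : ℕ → List ℚ → ℚ
weighted m []       = 0ℚ
weighted m (b ∷ bs) = ℕ→ℚ (m C length bs) * b + weighted m bs

-- Defs computes bernoulli (suc n) with its own private copy of weighted, so
-- the agreement of the two copies can only be stated with an inferred type.
bernoulli-suc : ∀ n → bernoulli (suc n) ≡ - ((+ 1 / suc (suc n)) * weighted (suc (suc n)) (bernRev n))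
bernoulli-suc n = unfolded
  where
  copies-agree : ∀ bs → _
  copies-agree []       = refl
  copies-agree (b ∷ bs) = cong (λ w → ℕ→ℚ (suc (suc n) C length bs) * b + w) (copies-agree bs)
  unfolded : bernoulli (suc n) ≡ - ((+ 1 / suc (suc n)) * weighted (suc (suc n)) (bernRev n))
  unfolded with bernRev n
  ... | bs = cong (λ w → - ((+ 1 / suc (suc n)) * w)) (copies-agree bs)

length-bernRev : ∀ n → length (bernRev n) ≡ suc n
length-bernRev zero    = refl
length-bernRev (suc n) = cong suc (length-bernRev n)

weighted-bernRev : ∀ m n → weighted m (bernRev n) ≡ Σ₀ n (λ k → C[ m , k ] * bernoulli k)
weighted-bernRev m zero    = +-identityʳ (1ℚ * 1ℚ)
weighted-bernRev m (suc n) = begin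
  ℕ→ℚ (m C length (bernRev n)) * bernoulli (suc n) + weighted m (bernRev n)
    ≡⟨ cong₂ (λ l w → ℕ→ℚ (m C l) * bernoulli (suc n) + w) (length-bernRev n) (weighted-bernRev m n) ⟩
  C[ m , suc n ] * bernoulli (suc n) + Σ₀ n (λ k → C[ m , k ] * bernoulli k)
    ≡⟨ +-comm (C[ m , suc n ] * bernoulli (suc n)) _ ⟩
  Σ₀ (suc n) (λ k → C[ m , k ] * bernoulli k) ∎

bernoulli-recurrence : ∀ n → Σ₀ (suc n) (λ k → C[ suc (suc n) , k ] * bernoulli k) ≡ 0ℚ
bernoulli-recurrence n = begin
  S + C[ suc (suc n) , suc n ] * bernoulli (suc n)
    ≡⟨ cong₂ (λ c b → S + ℕ→ℚ c * b) ([1+n]Cn≡1+n (suc n))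
         (trans (bernoulli-suc n) (cong (λ w → - ((+ 1 / suc (suc n)) * w)) (weighted-bernRev (suc (suc n)) n))) ⟩
  S + ℕ→ℚ (suc (suc n)) * (- ((+ 1 / suc (suc n)) * S))
    ≡⟨ regroup S (ℕ→ℚ (suc (suc n))) (+ 1 / suc (suc n)) ⟩
  S + (- ((ℕ→ℚ (suc (suc n)) * (+ 1 / suc (suc n))) * S))
    ≡⟨ cong (λ t → S + (- (t * S))) (n*[1/n]≡1 (suc (suc n))) ⟩
  S + (- (1ℚ * S))
    ≡⟨ cancel S ⟩
  0ℚ ∎
  where
  S = Σ₀ n (λ k → C[ suc (suc n) , k ] * bernoulli k)
  regroup : ∀ x a b → x + a * (- (b * x)) ≡ x + (- ((a * b) * x))
  regroup = solve-∀ ℚ-ring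
  cancel : ∀ x → x + (- (1ℚ * x)) ≡ 0ℚ
  cancel = solve-∀ ℚ-ring

bernoulliPoly-+ : ∀ n x h → bernoulliPoly n (x + h) ≡ Σ₀ n (λ j → C[ n , j ] * (bernoulliPoly j x * h ^ℚ (n ∸ j)))
bernoulliPoly-+ n x h = begin
  Σ₀ n (λ k → C[ n , k ] * bernoulli k * (x + h) ^ℚ (n ∸ k))
    ≡⟨ Σ₀-cong n (λ k → trans (cong (C[ n , k ] * bernoulli k *_) (binomial-theorem x h (n ∸ k)))
                               (sym (Σ₀-*-distribˡ (n ∸ k) (C[ n , k ] * bernoulli k) _))) ⟩
  Σ₀ n (λ k → Σ₀ (n ∸ k) (λ i → C[ n , k ] * bernoulli k * (C[ n ∸ k , i ] * (x ^ℚ i * h ^ℚ (n ∸ k ∸ i)))))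
    ≡⟨ Σ₀-cong n (λ k → Σ₀-cong (n ∸ k) (reindex k)) ⟩
  Σ₀ n (λ k → Σ₀ (n ∸ k) (λ i → F (k ℕ.+ i) k))
    ≡⟨ Σ₀-triangle-swap n F ⟨
  Σ₀ n (λ j → Σ₀ j (F j))
    ≡⟨ Σ₀-cong n (λ j → trans (Σ₀-*-distribˡ j (C[ n , j ] * h ^ℚ (n ∸ j)) _) (regroup C[ n , j ] (h ^ℚ (n ∸ j)) (bernoulliPoly j x))) ⟩
  Σ₀ n (λ j → C[ n , j ] * (bernoulliPoly j x * h ^ℚ (n ∸ j))) ∎
  where
  F : ℕ → ℕ → ℚ
  F j k = C[ n , j ] * h ^ℚ (n ∸ j) * (C[ j , k ] * bernoulli k * x ^ℚ (j ∸ k))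
  regroup : ∀ a b c → a * b * c ≡ a * (c * b)
  regroup = solve-∀ ℚ-ring
  reindex : ∀ k i → C[ n , k ] * bernoulli k * (C[ n ∸ k , i ] * (x ^ℚ i * h ^ℚ (n ∸ k ∸ i))) ≡ F (k ℕ.+ i) k
  reindex k i = begin
    C[ n , k ] * bernoulli k * (C[ n ∸ k , i ] * (x ^ℚ i * h ^ℚ (n ∸ k ∸ i)))
      ≡⟨ regroup₁ C[ n , k ] (bernoulli k) C[ n ∸ k , i ] (x ^ℚ i) (h ^ℚ (n ∸ k ∸ i)) ⟩
    (C[ n , k ] * C[ n ∸ k , i ]) * h ^ℚ (n ∸ k ∸ i) * (bernoulli k * x ^ℚ i)
      ≡⟨ cong₂ (λ c e → c * h ^ℚ e * (bernoulli k * x ^ℚ i)) (C[]-trinomial n k i) (sym (ℕP.∸-+-assoc n k i)) ⟨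
    (C[ n , k ℕ.+ i ] * C[ k ℕ.+ i , k ]) * h ^ℚ (n ∸ (k ℕ.+ i)) * (bernoulli k * x ^ℚ i)
      ≡⟨ cong (λ e → (C[ n , k ℕ.+ i ] * C[ k ℕ.+ i , k ]) * h ^ℚ (n ∸ (k ℕ.+ i)) * (bernoulli k * x ^ℚ e)) (ℕP.m+n∸m≡n k i) ⟨
    (C[ n , k ℕ.+ i ] * C[ k ℕ.+ i , k ]) * h ^ℚ (n ∸ (k ℕ.+ i)) * (bernoulli k * x ^ℚ (k ℕ.+ i ∸ k))
      ≡⟨ regroup₂ C[ n , k ℕ.+ i ] C[ k ℕ.+ i , k ] (h ^ℚ (n ∸ (k ℕ.+ i))) (bernoulli k) (x ^ℚ (k ℕ.+ i ∸ k)) ⟩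
    F (k ℕ.+ i) k ∎
    where
    regroup₁ : ∀ a b c d e → a * b * (c * (d * e)) ≡ (a * c) * e * (b * d)
    regroup₁ = solve-∀ ℚ-ring
    regroup₂ : ∀ a b c d e → (a * b) * c * (d * e) ≡ a * c * (b * d * e)
    regroup₂ = solve-∀ ℚ-ring

bernoulliPoly-0 : ∀ j → bernoulliPoly j 0ℚ ≡ bernoulli j
bernoulliPoly-0 zero    = refl
bernoulliPoly-0 (suc j) = begin
  Σ₀ j (λ k → C[ suc j , k ] * bernoulli k * 0ℚ ^ℚ (suc j ∸ k)) + C[ suc j , suc j ] * bernoulli (suc j) * 0ℚ ^ℚ (j ∸ j)
    ≡⟨ cong₂ _+_ (trans (Σ₀-cong-≤ j vanishes) (Σ₀-zero j))
                 (cong₂ (λ c e → ℕ→ℚ c * bernoulli (suc j) * 0ℚ ^ℚ e) (nCn≡1 (suc j)) (ℕP.n∸n≡0 j)) ⟩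
  0ℚ + 1ℚ * bernoulli (suc j) * 1ℚ
    ≡⟨ simplify (bernoulli (suc j)) ⟩
  bernoulli (suc j) ∎
  where
  vanishes : ∀ k → k ℕ.≤ j → C[ suc j , k ] * bernoulli k * 0ℚ ^ℚ (suc j ∸ k) ≡ 0ℚ
  vanishes k k≤j = trans (cong (λ e → C[ suc j , k ] * bernoulli k * 0ℚ ^ℚ e) (ℕP.+-∸-assoc 1 k≤j))
    (trans (cong (C[ suc j , k ] * bernoulli k *_) (0^[1+n]≡0 (j ∸ k))) (*-zeroʳ (C[ suc j , k ] * bernoulli k)))
  simplify : ∀ b → 0ℚ + 1ℚ * b * 1ℚ ≡ b
  simplify = solve-∀ ℚ-ring

isOne : ℕ → ℚ
isOne 1 = 1ℚ
isOne _ = 0ℚ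

bernoulliPoly-1 : ∀ j → bernoulliPoly j 1ℚ ≡ bernoulliPoly j 0ℚ + isOne j
bernoulliPoly-1 j = trans (Σ₀-cong j at-one) (lemma j)
  where
  at-one : ∀ k → C[ j , k ] * bernoulli k * 1ℚ ^ℚ (j ∸ k) ≡ C[ j , k ] * bernoulli k
  at-one k = trans (cong (C[ j , k ] * bernoulli k *_) (1^n≡1 (j ∸ k))) (*-identityʳ (C[ j , k ] * bernoulli k))
  lemma : ∀ j → Σ₀ j (λ k → C[ j , k ] * bernoulli k) ≡ bernoulliPoly j 0ℚ + isOne j
  lemma zero          = refl
  lemma (suc zero)    = trans (simplify (bernoulli 1)) (cong (_+ 1ℚ) (sym (bernoulliPoly-0 1)))
    where
    simplify : ∀ b → 1ℚ * 1ℚ + 1ℚ * b ≡ b + 1ℚ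
    simplify = solve-∀ ℚ-ring
  lemma (suc (suc n)) = begin
    Σ₀ (suc n) (λ k → C[ suc (suc n) , k ] * bernoulli k) + C[ suc (suc n) , suc (suc n) ] * bernoulli (suc (suc n))
      ≡⟨ cong₂ _+_ (bernoulli-recurrence n) (cong (λ c → ℕ→ℚ c * bernoulli (suc (suc n))) (nCn≡1 (suc (suc n)))) ⟩
    0ℚ + 1ℚ * bernoulli (suc (suc n))
      ≡⟨ simplify (bernoulli (suc (suc n))) ⟩
    bernoulli (suc (suc n)) + 0ℚ
      ≡⟨ cong (_+ 0ℚ) (bernoulliPoly-0 (suc (suc n))) ⟨
    bernoulliPoly (suc (suc n)) 0ℚ + 0ℚ ∎
    where
    simplify : ∀ b → 0ℚ + 1ℚ * b ≡ b + 0ℚ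
    simplify = solve-∀ ℚ-ring

Σ₀-isOne : ∀ n (g : ℕ → ℚ) → Σ₀ (suc n) (λ j → g j * isOne j) ≡ g 1
Σ₀-isOne n g = begin
  Σ₀ (suc n) (λ j → g j * isOne j)                 ≡⟨ Σ₀-unfoldˡ n (λ j → g j * isOne j) ⟩
  g 0 * 0ℚ + Σ₀ n (λ j → g (suc j) * isOne (suc j)) ≡⟨ cong (λ t → g 0 * 0ℚ + t) (tail n) ⟩
  g 0 * 0ℚ + g 1                                   ≡⟨ simplify (g 0) (g 1) ⟩
  g 1                                              ∎
  where
  simplify : ∀ a b → a * 0ℚ + b ≡ b
  simplify = solve-∀ ℚ-ring
  tail : ∀ n → Σ₀ n (λ j → g (suc j) * isOne (suc j)) ≡ g 1
  tail zero    = *-identityʳ (g 1)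
  tail (suc n) = trans (cong₂ _+_ (tail n) (*-zeroʳ (g (suc (suc n))))) (+-identityʳ (g 1))

bernoulliPoly-difference : ∀ n y → bernoulliPoly (suc n) (y + 1ℚ) ≡ bernoulliPoly (suc n) y + ℕ→ℚ (suc n) * y ^ℚ n
bernoulliPoly-difference n y = begin
  bernoulliPoly (suc n) (y + 1ℚ)
    ≡⟨ cong (bernoulliPoly (suc n)) (+-comm y 1ℚ) ⟩
  bernoulliPoly (suc n) (1ℚ + y)
    ≡⟨ bernoulliPoly-+ (suc n) 1ℚ y ⟩
  Σ₀ (suc n) (λ j → C[ suc n , j ] * (bernoulliPoly j 1ℚ * y ^ℚ (suc n ∸ j)))
    ≡⟨ Σ₀-cong (suc n) (λ j → trans (cong (λ b → C[ suc n , j ] * (b * y ^ℚ (suc n ∸ j))) (bernoulliPoly-1 j))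
                                    (expand C[ suc n , j ] (bernoulliPoly j 0ℚ) (isOne j) (y ^ℚ (suc n ∸ j)))) ⟩
  Σ₀ (suc n) (λ j → C[ suc n , j ] * (bernoulliPoly j 0ℚ * y ^ℚ (suc n ∸ j)) + C[ suc n , j ] * y ^ℚ (suc n ∸ j) * isOne j)
    ≡⟨ Σ₀-distrib-+ (suc n) _ _ ⟩
  Σ₀ (suc n) (λ j → C[ suc n , j ] * (bernoulliPoly j 0ℚ * y ^ℚ (suc n ∸ j))) + Σ₀ (suc n) (λ j → C[ suc n , j ] * y ^ℚ (suc n ∸ j) * isOne j)
    ≡⟨ cong₂ _+_ (sym (bernoulliPoly-+ (suc n) 0ℚ y)) (Σ₀-isOne n (λ j → C[ suc n , j ] * y ^ℚ (suc n ∸ j))) ⟩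
  bernoulliPoly (suc n) (0ℚ + y) + C[ suc n , 1 ] * y ^ℚ n
    ≡⟨ cong₂ (λ z c → bernoulliPoly (suc n) z + ℕ→ℚ c * y ^ℚ n) (+-identityˡ y) (nC1≡n (suc n)) ⟩
  bernoulliPoly (suc n) y + ℕ→ℚ (suc n) * y ^ℚ n ∎
  where
  expand : ∀ a b c d → a * ((b + c) * d) ≡ a * (b * d) + a * d * c
  expand = solve-∀ ℚ-ring

sgn*bernoulliPoly-shift : ∀ n y → sgn n * bernoulliPoly n y ≡ Σ₀ n (λ j → C[ n , j ] * sgn j * bernoulliPoly j (y + 1ℚ))
sgn*bernoulliPoly-shift n y = begin
  sgn n * bernoulliPoly n y
    ≡⟨ cong (λ z → sgn n * bernoulliPoly n z) (back y) ⟩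
  sgn n * bernoulliPoly n (y′ + (- 1ℚ))
    ≡⟨ cong (sgn n *_) (bernoulliPoly-+ n y′ (- 1ℚ)) ⟩
  sgn n * Σ₀ n (λ j → C[ n , j ] * (bernoulliPoly j y′ * (- 1ℚ) ^ℚ (n ∸ j)))
    ≡⟨ trans (sym (Σ₀-*-distribˡ n (sgn n) _)) (Σ₀-cong-≤ n collect-signs) ⟩
  Σ₀ n (λ j → C[ n , j ] * sgn j * bernoulliPoly j y′) ∎
  where
  y′ = y + 1ℚ
  back : ∀ y → y ≡ (y + 1ℚ) + (- 1ℚ)
  back = solve-∀ ℚ-ring
  collect-signs : ∀ j → j ℕ.≤ n → sgn n * (C[ n , j ] * (bernoulliPoly j y′ * (- 1ℚ) ^ℚ (n ∸ j)))
                                ≡ C[ n , j ] * sgn j * bernoulliPoly j y′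
  collect-signs j j≤n = begin
    sgn n * (C[ n , j ] * (bernoulliPoly j y′ * (- 1ℚ) ^ℚ (n ∸ j)))
      ≡⟨ cong (λ s → sgn n * (C[ n , j ] * (bernoulliPoly j y′ * s))) ([-1]^n≡sgn (n ∸ j)) ⟩
    sgn n * (C[ n , j ] * (bernoulliPoly j y′ * sgn (n ∸ j)))
      ≡⟨ regroup (sgn n) C[ n , j ] (bernoulliPoly j y′) (sgn (n ∸ j)) ⟩
    C[ n , j ] * (sgn n * sgn (n ∸ j)) * bernoulliPoly j y′
      ≡⟨ cong (λ s → C[ n , j ] * s * bernoulliPoly j y′) (sgn-∸ j≤n) ⟩
    C[ n , j ] * sgn j * bernoulliPoly j y′ ∎
    where
    regroup : ∀ a b c d → a * (b * (c * d)) ≡ b * (a * d) * c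
    regroup = solve-∀ ℚ-ring

-- The functional L_y and derivatives of powers

bernoulliWeight : ℚ → ℕ → ℚ
bernoulliWeight y j = sgn (suc j) * ℕ→ℚ j * bernoulliPoly (j ∸ 1) y

-- ∂pow t j and ∂²pow t j are the first and second derivatives of x ^ j at t,
-- computed through the Leibniz rule for x ^ (j + 1) = x · x ^ j.
∂pow : ℚ → ℕ → ℚ
∂pow t zero    = 0ℚ
∂pow t (suc j) = t * ∂pow t j + t ^ℚ j

∂²pow : ℚ → ℕ → ℚ
∂²pow t zero    = 0ℚ
∂²pow t (suc j) = t * ∂²pow t j + ℕ→ℚ 2 * ∂pow t j

∂pow-suc : ∀ t j → ∂pow t (suc j) ≡ ℕ→ℚ (suc j) * t ^ℚ j
∂pow-suc t zero    = base t
  where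
  base : ∀ t → t * 0ℚ + 1ℚ ≡ 1ℚ * 1ℚ
  base = solve-∀ ℚ-ring
∂pow-suc t (suc j) = begin
  t * ∂pow t (suc j) + t * t ^ℚ j               ≡⟨ cong (λ d → t * d + t * t ^ℚ j) (∂pow-suc t j) ⟩
  t * (ℕ→ℚ (suc j) * t ^ℚ j) + t * t ^ℚ j       ≡⟨ step t (ℕ→ℚ (suc j)) (t ^ℚ j) ⟩
  (1ℚ + ℕ→ℚ (suc j)) * (t * t ^ℚ j)             ≡⟨ cong (_* (t * t ^ℚ j)) (ℕ→ℚ-suc (suc j)) ⟨
  ℕ→ℚ (suc (suc j)) * (t * t ^ℚ j)              ∎
  where
  step : ∀ t a p → t * (a * p) + t * p ≡ (1ℚ + a) * (t * p)
  step = solve-∀ ℚ-ring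

∂²pow-1 : ∀ t → ∂²pow t 1 ≡ 0ℚ
∂²pow-1 t = zero-terms t
  where
  zero-terms : ∀ t → t * 0ℚ + ℕ→ℚ 2 * 0ℚ ≡ 0ℚ
  zero-terms = solve-∀ ℚ-ring

∂²pow-suc-suc : ∀ t j → ∂²pow t (suc (suc j)) ≡ ℕ→ℚ (suc (suc j)) * ℕ→ℚ (suc j) * t ^ℚ j
∂²pow-suc-suc t zero    = base t
  where
  base : ∀ t → t * (t * 0ℚ + ℕ→ℚ 2 * 0ℚ) + ℕ→ℚ 2 * (t * 0ℚ + 1ℚ) ≡ ℕ→ℚ 2 * 1ℚ * 1ℚ
  base = solve-∀ ℚ-ring
∂²pow-suc-suc t (suc j) = begin
  t * ∂²pow t (suc (suc j)) + ℕ→ℚ 2 * ∂pow t (suc (suc j))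
    ≡⟨ cong₂ (λ a b → t * a + ℕ→ℚ 2 * b) (∂²pow-suc-suc t j) (∂pow-suc t (suc j)) ⟩
  t * (c₂ * c₁ * t ^ℚ j) + ℕ→ℚ 2 * (c₂ * (t * t ^ℚ j))
    ≡⟨ cong (λ a → t * (a * c₁ * t ^ℚ j) + ℕ→ℚ 2 * (a * (t * t ^ℚ j))) (ℕ→ℚ-suc (suc j)) ⟩
  t * ((1ℚ + c₁) * c₁ * t ^ℚ j) + ℕ→ℚ 2 * ((1ℚ + c₁) * (t * t ^ℚ j))
    ≡⟨ step t c₁ (t ^ℚ j) ⟩
  (1ℚ + (1ℚ + c₁)) * (1ℚ + c₁) * (t * t ^ℚ j)
    ≡⟨ cong (λ a → (1ℚ + a) * a * (t * t ^ℚ j)) (ℕ→ℚ-suc (suc j)) ⟨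
  (1ℚ + c₂) * c₂ * (t * t ^ℚ j)
    ≡⟨ cong (λ a → a * c₂ * (t * t ^ℚ j)) (ℕ→ℚ-suc (suc (suc j))) ⟨
  ℕ→ℚ (suc (suc (suc j))) * c₂ * (t * t ^ℚ j) ∎
  where
  c₁ = ℕ→ℚ (suc j)
  c₂ = ℕ→ℚ (suc (suc j))
  step : ∀ t b p → t * ((1ℚ + b) * b * p) + ℕ→ℚ 2 * ((1ℚ + b) * (t * p)) ≡ (1ℚ + (1ℚ + b)) * (1ℚ + b) * (t * p)
  step = solve-∀ ℚ-ring

bernoulliWeight-shift : ∀ y i → bernoulliWeight y i ≡ Σ₀ i (λ l → C[ i , l ] * bernoulliWeight (y + 1ℚ) l)
bernoulliWeight-shift y zero    = both-zero (sgn 1) (bernoulliPoly 0 y) (bernoulliPoly 0 (y + 1ℚ))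
  where
  both-zero : ∀ s b c → s * 0ℚ * b ≡ 1ℚ * (s * 0ℚ * c)
  both-zero = solve-∀ ℚ-ring
bernoulliWeight-shift y (suc n) = begin
  sgn (suc (suc n)) * ℕ→ℚ (suc n) * bernoulliPoly n y
    ≡⟨ cong (λ s → s * ℕ→ℚ (suc n) * bernoulliPoly n y) (sgn-suc-suc n) ⟩
  sgn n * ℕ→ℚ (suc n) * bernoulliPoly n y
    ≡⟨ swap (sgn n) (ℕ→ℚ (suc n)) (bernoulliPoly n y) ⟩
  ℕ→ℚ (suc n) * (sgn n * bernoulliPoly n y)
    ≡⟨ cong (ℕ→ℚ (suc n) *_) (sgn*bernoulliPoly-shift n y) ⟩
  ℕ→ℚ (suc n) * Σ₀ n (λ j → C[ n , j ] * sgn j * bernoulliPoly j y′)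
    ≡⟨ trans (sym (Σ₀-*-distribˡ n (ℕ→ℚ (suc n)) _)) (Σ₀-cong n absorb) ⟩
  Σ₀ n (λ j → C[ suc n , suc j ] * bernoulliWeight y′ (suc j))
    ≡⟨ head-zero (bernoulliPoly 0 y′) _ ⟩
  C[ suc n , 0 ] * bernoulliWeight y′ 0 + Σ₀ n (λ j → C[ suc n , suc j ] * bernoulliWeight y′ (suc j))
    ≡⟨ Σ₀-unfoldˡ n (λ l → C[ suc n , l ] * bernoulliWeight y′ l) ⟨
  Σ₀ (suc n) (λ l → C[ suc n , l ] * bernoulliWeight y′ l) ∎
  where
  y′ = y + 1ℚ
  swap : ∀ a b c → a * b * c ≡ b * (a * c)
  swap = solve-∀ ℚ-ring
  head-zero : ∀ b S → S ≡ 1ℚ * (- 1ℚ * 0ℚ * b) + S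
  head-zero = solve-∀ ℚ-ring
  absorb : ∀ j → ℕ→ℚ (suc n) * (C[ n , j ] * sgn j * bernoulliPoly j y′) ≡ C[ suc n , suc j ] * bernoulliWeight y′ (suc j)
  absorb j = begin
    ℕ→ℚ (suc n) * (C[ n , j ] * sgn j * bernoulliPoly j y′)
      ≡⟨ regroup₁ (ℕ→ℚ (suc n)) C[ n , j ] (sgn j) (bernoulliPoly j y′) ⟩
    ℕ→ℚ (suc n) * C[ n , j ] * sgn j * bernoulliPoly j y′
      ≡⟨ cong₂ (λ c s → c * s * bernoulliPoly j y′) (C[]-absorb n j) (sgn-suc-suc j) ⟨
    ℕ→ℚ (suc j) * C[ suc n , suc j ] * sgn (suc (suc j)) * bernoulliPoly j y′
      ≡⟨ regroup₂ (ℕ→ℚ (suc j)) C[ suc n , suc j ] (sgn (suc (suc j))) (bernoulliPoly j y′) ⟩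
    C[ suc n , suc j ] * bernoulliWeight y′ (suc j) ∎
    where
    regroup₁ : ∀ a b c d → a * (b * c * d) ≡ a * b * c * d
    regroup₁ = solve-∀ ℚ-ring
    regroup₂ : ∀ a b c d → a * b * c * d ≡ b * (c * a * d)
    regroup₂ = solve-∀ ℚ-ring

bernoulliWeight-difference : ∀ y j → bernoulliWeight y j ≡ bernoulliWeight (y + 1ℚ) j + ∂²pow (- y) j
bernoulliWeight-difference y zero          = both-zero (sgn 1) (bernoulliPoly 0 y) (bernoulliPoly 0 (y + 1ℚ))
  where
  both-zero : ∀ s b c → s * 0ℚ * b ≡ s * 0ℚ * c + 0ℚ
  both-zero = solve-∀ ℚ-ring
bernoulliWeight-difference y (suc zero)    =
  trans (sym (+-identityʳ (bernoulliWeight (y + 1ℚ) 1))) (cong (λ d → bernoulliWeight (y + 1ℚ) 1 + d) (sym (∂²pow-1 (- y))))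
bernoulliWeight-difference y (suc (suc k)) = begin
  sgn (suc (suc (suc k))) * c * bernoulliPoly (suc k) y
    ≡⟨ cong (λ s → s * c * bernoulliPoly (suc k) y) (sgn-suc-suc (suc k)) ⟩
  - sgn k * c * bernoulliPoly (suc k) y
    ≡⟨ split (sgn k) c (bernoulliPoly (suc k) y) (ℕ→ℚ (suc k)) (y ^ℚ k) ⟩
  - sgn k * c * (bernoulliPoly (suc k) y + ℕ→ℚ (suc k) * y ^ℚ k) + c * ℕ→ℚ (suc k) * (sgn k * y ^ℚ k)
    ≡⟨ cong₂ (λ b p → - sgn k * c * b + c * ℕ→ℚ (suc k) * p) (bernoulliPoly-difference k y) ([-y]^n≡sgn*y^n y k) ⟨
  - sgn k * c * bernoulliPoly (suc k) (y + 1ℚ) + c * ℕ→ℚ (suc k) * (- y) ^ℚ k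
    ≡⟨ cong₂ (λ s d → s * c * bernoulliPoly (suc k) (y + 1ℚ) + d) (sgn-suc-suc (suc k)) (∂²pow-suc-suc (- y) k) ⟨
  sgn (suc (suc (suc k))) * c * bernoulliPoly (suc k) (y + 1ℚ) + ∂²pow (- y) (suc (suc k)) ∎
  where
  c = ℕ→ℚ (suc (suc k))
  split : ∀ s a b c p → - s * a * b ≡ - s * a * (b + c * p) + a * c * (s * p)
  split = solve-∀ ℚ-ring

-- Rising factorials

-- applyRising f M N i is the value of the linear functional x ^ j ↦ f j on the
-- polynomial x ^ i (x + M) (x + M + 1) ⋯ (x + M + N - 1).
applyRising : (ℕ → ℚ) → ℚ → ℕ → ℕ → ℚ
applyRising f M zero    i = f i
applyRising f M (suc N) i = (M + ℕ→ℚ N) * applyRising f M N i + applyRising f M N (suc i)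

applyRising-+ : ∀ {f g h : ℕ → ℚ} M → (∀ j → f j ≡ g j + h j) →
  ∀ N i → applyRising f M N i ≡ applyRising g M N i + applyRising h M N i
applyRising-+ M f≡g+h zero    i = f≡g+h i
applyRising-+ {f} {g} {h} M f≡g+h (suc N) i = begin
  (M + ℕ→ℚ N) * applyRising f M N i + applyRising f M N (suc i)
    ≡⟨ cong₂ (λ a b → (M + ℕ→ℚ N) * a + b) (applyRising-+ M f≡g+h N i) (applyRising-+ M f≡g+h N (suc i)) ⟩
  (M + ℕ→ℚ N) * (applyRising g M N i + applyRising h M N i) + (applyRising g M N (suc i) + applyRising h M N (suc i))
    ≡⟨ regroup (M + ℕ→ℚ N) (applyRising g M N i) (applyRising h M N i) (applyRising g M N (suc i)) (applyRising h M N (suc i)) ⟩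
  ((M + ℕ→ℚ N) * applyRising g M N i + applyRising g M N (suc i)) + ((M + ℕ→ℚ N) * applyRising h M N i + applyRising h M N (suc i)) ∎
  where
  regroup : ∀ c a b a′ b′ → c * (a + b) + (a′ + b′) ≡ (c * a + a′) + (c * b + b′)
  regroup = solve-∀ ℚ-ring

applyRising-scale : ∀ {f g : ℕ → ℚ} M c → (∀ j → f j ≡ c * g j) → ∀ N i → applyRising f M N i ≡ c * applyRising g M N i
applyRising-scale M c f≡cg zero    i = f≡cg i
applyRising-scale {f} {g} M c f≡cg (suc N) i = begin
  (M + ℕ→ℚ N) * applyRising f M N i + applyRising f M N (suc i)
    ≡⟨ cong₂ (λ a b → (M + ℕ→ℚ N) * a + b) (applyRising-scale M c f≡cg N i) (applyRising-scale M c f≡cg N (suc i)) ⟩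
  (M + ℕ→ℚ N) * (c * applyRising g M N i) + c * applyRising g M N (suc i)
    ≡⟨ regroup (M + ℕ→ℚ N) c (applyRising g M N i) (applyRising g M N (suc i)) ⟩
  c * ((M + ℕ→ℚ N) * applyRising g M N i + applyRising g M N (suc i)) ∎
  where
  regroup : ∀ m c a b → m * (c * a) + c * b ≡ c * (m * a + b)
  regroup = solve-∀ ℚ-ring

applyRising-zero : ∀ M N i → applyRising (λ _ → 0ℚ) M N i ≡ 0ℚ
applyRising-zero M zero    i = refl
applyRising-zero M (suc N) i =
  trans (cong₂ (λ a b → (M + ℕ→ℚ N) * a + b) (applyRising-zero M N i) (applyRising-zero M N (suc i)))
        (trans (+-identityʳ _) (*-zeroʳ (M + ℕ→ℚ N)))

applyRising-suc : ∀ {f g : ℕ → ℚ} M t → (∀ j → f (suc j) ≡ t * f j + g j) →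
  ∀ N i → applyRising f M N (suc i) ≡ t * applyRising f M N i + applyRising g M N i
applyRising-suc M t rec zero    i = rec i
applyRising-suc {f} {g} M t rec (suc N) i = begin
  (M + ℕ→ℚ N) * applyRising f M N (suc i) + applyRising f M N (suc (suc i))
    ≡⟨ cong₂ (λ a b → (M + ℕ→ℚ N) * a + b) (applyRising-suc M t rec N i) (applyRising-suc M t rec N (suc i)) ⟩
  (M + ℕ→ℚ N) * (t * applyRising f M N i + applyRising g M N i) + (t * applyRising f M N (suc i) + applyRising g M N (suc i))
    ≡⟨ regroup (M + ℕ→ℚ N) t (applyRising f M N i) (applyRising g M N i) (applyRising f M N (suc i)) (applyRising g M N (suc i)) ⟩
  t * ((M + ℕ→ℚ N) * applyRising f M N i + applyRising f M N (suc i)) + ((M + ℕ→ℚ N) * applyRising g M N i + applyRising g M N (suc i)) ∎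
  where
  regroup : ∀ m t a b a′ b′ → m * (t * a + b) + (t * a′ + b′) ≡ t * (m * a + a′) + (m * b + b′)
  regroup = solve-∀ ℚ-ring

applyRising-factor : ∀ (f : ℕ → ℚ) M N i →
  applyRising f M (suc N) i ≡ M * applyRising f (M + 1ℚ) N i + applyRising f (M + 1ℚ) N (suc i)
applyRising-factor f M zero    i = cong (λ m → m * f i + f (suc i)) (+-identityʳ M)
applyRising-factor f M (suc N) i = begin
  (M + ℕ→ℚ (suc N)) * applyRising f M (suc N) i + applyRising f M (suc N) (suc i)
    ≡⟨ cong₂ (λ a b → (M + ℕ→ℚ (suc N)) * a + b) (applyRising-factor f M N i) (applyRising-factor f M N (suc i)) ⟩
  (M + ℕ→ℚ (suc N)) * (M * A₀ + A₁) + (M * A₁ + A₂)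
    ≡⟨ cong (λ n → (M + n) * (M * A₀ + A₁) + (M * A₁ + A₂)) (ℕ→ℚ-suc N) ⟩
  (M + (1ℚ + ℕ→ℚ N)) * (M * A₀ + A₁) + (M * A₁ + A₂)
    ≡⟨ regroup M (ℕ→ℚ N) A₀ A₁ A₂ ⟩
  M * ((M + 1ℚ + ℕ→ℚ N) * A₀ + A₁) + ((M + 1ℚ + ℕ→ℚ N) * A₁ + A₂) ∎
  where
  A₀ = applyRising f (M + 1ℚ) N i
  A₁ = applyRising f (M + 1ℚ) N (suc i)
  A₂ = applyRising f (M + 1ℚ) N (suc (suc i))
  regroup : ∀ m n a₀ a₁ a₂ → (m + (1ℚ + n)) * (m * a₀ + a₁) + (m * a₁ + a₂) ≡ m * ((m + 1ℚ + n) * a₀ + a₁) + ((m + 1ℚ + n) * a₁ + a₂)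
  regroup = solve-∀ ℚ-ring

applyRising-pascal : ∀ (f : ℕ → ℚ) M N i →
  applyRising f (M + 1ℚ) (suc N) i ≡ applyRising f M (suc N) i + ℕ→ℚ (suc N) * applyRising f (M + 1ℚ) N i
applyRising-pascal f M N i = begin
  (M + 1ℚ + ℕ→ℚ N) * A₀ + A₁            ≡⟨ regroup M (ℕ→ℚ N) A₀ A₁ ⟩
  (M * A₀ + A₁) + (1ℚ + ℕ→ℚ N) * A₀     ≡⟨ cong₂ (λ a n → a + n * A₀) (applyRising-factor f M N i) (ℕ→ℚ-suc N) ⟨
  applyRising f M (suc N) i + ℕ→ℚ (suc N) * A₀ ∎
  where
  A₀ = applyRising f (M + 1ℚ) N i
  A₁ = applyRising f (M + 1ℚ) N (suc i)
  regroup : ∀ m n a₀ a₁ → (m + 1ℚ + n) * a₀ + a₁ ≡ (m * a₀ + a₁) + (1ℚ + n) * a₀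
  regroup = solve-∀ ℚ-ring

applyRising-shift : ∀ {f g : ℕ → ℚ} M → (∀ i → f i ≡ Σ₀ i (λ l → C[ i , l ] * g l)) →
  ∀ N i → applyRising f M N i ≡ Σ₀ i (λ l → C[ i , l ] * applyRising g (M + 1ℚ) N l)
applyRising-shift M f≡ zero    i = f≡ i
applyRising-shift {f} {g} M f≡ (suc N) i = begin
  (M + ℕ→ℚ N) * applyRising f M N i + applyRising f M N (suc i)
    ≡⟨ cong₂ (λ a b → (M + ℕ→ℚ N) * a + b) (applyRising-shift M f≡ N i) (applyRising-shift M f≡ N (suc i)) ⟩
  (M + ℕ→ℚ N) * S₀ + Σ₀ (suc i) (λ l → C[ suc i , l ] * G l)
    ≡⟨ cong (λ s → (M + ℕ→ℚ N) * S₀ + s) (Σ₀-pascal i G) ⟩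
  (M + ℕ→ℚ N) * S₀ + (S₀ + S₁)
    ≡⟨ regroup M (ℕ→ℚ N) S₀ S₁ ⟩
  (M + 1ℚ + ℕ→ℚ N) * S₀ + S₁
    ≡⟨ cong (_+ S₁) (Σ₀-*-distribˡ i (M + 1ℚ + ℕ→ℚ N) _) ⟨
  Σ₀ i (λ l → (M + 1ℚ + ℕ→ℚ N) * (C[ i , l ] * G l)) + S₁
    ≡⟨ Σ₀-distrib-+ i _ _ ⟨
  Σ₀ i (λ l → (M + 1ℚ + ℕ→ℚ N) * (C[ i , l ] * G l) + C[ i , l ] * G (suc l))
    ≡⟨ Σ₀-cong i (λ l → factor (M + 1ℚ + ℕ→ℚ N) C[ i , l ] (G l) (G (suc l))) ⟩
  Σ₀ i (λ l → C[ i , l ] * applyRising g (M + 1ℚ) (suc N) l) ∎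
  where
  G = applyRising g (M + 1ℚ) N
  S₀ = Σ₀ i (λ l → C[ i , l ] * G l)
  S₁ = Σ₀ i (λ l → C[ i , l ] * G (suc l))
  regroup : ∀ m n s₀ s₁ → (m + n) * s₀ + (s₀ + s₁) ≡ (m + 1ℚ + n) * s₀ + s₁
  regroup = solve-∀ ℚ-ring
  factor : ∀ c b x y → c * (b * x) + b * y ≡ b * (c * x + y)
  factor = solve-∀ ℚ-ring

-- risingCoeff N k M is the coefficient of x ^ k in (x + M) (x + M + 1) ⋯ (x + M + N - 1),
-- the r-Stirling number of the first kind for a rational parameter M.
risingCoeff : ℕ → ℕ → ℚ → ℚ
risingCoeff zero    zero    M = 1ℚ
risingCoeff zero    (suc k) M = 0ℚ
risingCoeff (suc N) zero    M = (M + ℕ→ℚ N) * risingCoeff N zero M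
risingCoeff (suc N) (suc k) M = risingCoeff N k M + (M + ℕ→ℚ N) * risingCoeff N (suc k) M

risingCoeff-vanish : ∀ {N k} M → N ℕ.< k → risingCoeff N k M ≡ 0ℚ
risingCoeff-vanish {zero}  {suc k} M _ = refl
risingCoeff-vanish {suc N} {suc k} M (s≤s N<k) =
  trans (cong₂ (λ a b → a + (M + ℕ→ℚ N) * b) (risingCoeff-vanish M N<k) (risingCoeff-vanish M (ℕP.m<n⇒m<1+n N<k)))
        (trans (+-identityˡ _) (*-zeroʳ (M + ℕ→ℚ N)))

Σ-risingCoeff≡applyRising : ∀ (f : ℕ → ℚ) M N i → Σ₀ N (λ k → risingCoeff N k M * f (k ℕ.+ i)) ≡ applyRising f M N i
Σ-risingCoeff≡applyRising f M zero    i = *-identityˡ (f i)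
Σ-risingCoeff≡applyRising f M (suc N) i = begin
  Σ₀ (suc N) (λ k → risingCoeff (suc N) k M * f (k ℕ.+ i))
    ≡⟨ Σ₀-unfoldˡ N (λ k → risingCoeff (suc N) k M * f (k ℕ.+ i)) ⟩
  c * a₀ * f i + Σ₀ N (λ k → (risingCoeff N k M + c * risingCoeff N (suc k) M) * f (suc (k ℕ.+ i)))
    ≡⟨ cong (λ s → c * a₀ * f i + s) (trans (Σ₀-cong N split) (Σ₀-distrib-+ N _ _)) ⟩
  c * a₀ * f i + (Σ₀ N (λ k → risingCoeff N k M * f (suc (k ℕ.+ i))) + Σ₀ N (λ k → c * (risingCoeff N (suc k) M * f (suc k ℕ.+ i))))
    ≡⟨ cong₂ (λ a b → c * a₀ * f i + (a + b))
         (Σ₀-cong N (λ k → cong (λ j → risingCoeff N k M * f j) (sym (ℕP.+-suc k i))))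
         (Σ₀-*-distribˡ N c _) ⟩
  c * a₀ * f i + (Σ₀ N (λ k → risingCoeff N k M * f (k ℕ.+ suc i)) + c * Σ₀ N (λ k → risingCoeff N (suc k) M * f (suc k ℕ.+ i)))
    ≡⟨ cong₂ (λ a b → c * a₀ * f i + (a + c * b)) (Σ-risingCoeff≡applyRising f M N (suc i)) (Σ₀-suc≡Σ₁ N term) ⟩
  c * a₀ * f i + (applyRising f M N (suc i) + c * (Σ₁ N term + risingCoeff N (suc N) M * f (suc N ℕ.+ i)))
    ≡⟨ cong (λ r → c * a₀ * f i + (applyRising f M N (suc i) + c * (Σ₁ N term + r * f (suc N ℕ.+ i))))
            (risingCoeff-vanish M (ℕP.n<1+n N)) ⟩
  c * a₀ * f i + (applyRising f M N (suc i) + c * (Σ₁ N term + 0ℚ * f (suc N ℕ.+ i)))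
    ≡⟨ regroup c a₀ (f i) (applyRising f M N (suc i)) (Σ₁ N term) (f (suc N ℕ.+ i)) ⟩
  c * (term 0 + Σ₁ N term) + applyRising f M N (suc i)
    ≡⟨ cong (λ s → c * s + applyRising f M N (suc i)) (trans (sym (Σ₀≡f0+Σ₁ N term)) (Σ-risingCoeff≡applyRising f M N i)) ⟩
  c * applyRising f M N i + applyRising f M N (suc i) ∎
  where
  c = M + ℕ→ℚ N
  a₀ = risingCoeff N 0 M
  term : ℕ → ℚ
  term k = risingCoeff N k M * f (k ℕ.+ i)
  split : ∀ k → (risingCoeff N k M + c * risingCoeff N (suc k) M) * f (suc (k ℕ.+ i))
              ≡ risingCoeff N k M * f (suc (k ℕ.+ i)) + c * (risingCoeff N (suc k) M * f (suc k ℕ.+ i))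
  split k = trans (*-distribʳ-+ (f (suc (k ℕ.+ i))) (risingCoeff N k M) (c * risingCoeff N (suc k) M))
                  (cong (λ t → risingCoeff N k M * f (suc (k ℕ.+ i)) + t) (*-assoc c (risingCoeff N (suc k) M) (f (suc (k ℕ.+ i)))))
  regroup : ∀ c a x p q y → c * a * x + (p + c * (q + 0ℚ * y)) ≡ c * (a * x + q) + p
  regroup = solve-∀ ℚ-ring

-- As for bernoulli-suc, the polynomial operations of Defs are private, so the
-- helpers below proving the unfolding over an arbitrary coefficient list have inferred types.
rStirling₁-suc-suc : ∀ m n k → rStirling₁ (suc n) (suc k) m ≡ rStirling₁ n k m ℕ.+ (m ℕ.+ n) ℕ.* rStirling₁ n (suc k) m
rStirling₁-suc-suc m n = unfolded
  where
  on-lists : ∀ a c p k → _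
  on-lists a c []            k       = sym (ℕP.*-zeroʳ c)
  on-lists a c (b ∷ [])      zero    = sym (trans (cong (b ℕ.+_) (ℕP.*-zeroʳ c)) (ℕP.+-identityʳ b))
  on-lists a c (b ∷ (d ∷ p)) zero    = refl
  on-lists a c (b ∷ p)       (suc k) = on-lists b c p k
  unfolded : ∀ k → rStirling₁ (suc n) (suc k) m ≡ rStirling₁ n k m ℕ.+ (m ℕ.+ n) ℕ.* rStirling₁ n (suc k) m
  unfolded with 0 | m ℕ.+ n | risingPoly m n
  ... | a | c | p = on-lists a c p

rStirling₁-suc-zero : ∀ m n → rStirling₁ (suc n) 0 m ≡ (m ℕ.+ n) ℕ.* rStirling₁ n 0 m
rStirling₁-suc-zero m n = unfolded
  where
  on-lists : ∀ c p → _
  on-lists c []      = sym (ℕP.*-zeroʳ c)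
  on-lists c (b ∷ p) = refl
  unfolded : rStirling₁ (suc n) 0 m ≡ (m ℕ.+ n) ℕ.* rStirling₁ n 0 m
  unfolded with m ℕ.+ n | risingPoly m n
  ... | c | p = on-lists c p

rStirling₁≡risingCoeff : ∀ m n k → ℕ→ℚ (rStirling₁ n k m) ≡ risingCoeff n k (ℕ→ℚ m)
rStirling₁≡risingCoeff m zero    zero    = refl
rStirling₁≡risingCoeff m zero    (suc k) = refl
rStirling₁≡risingCoeff m (suc n) zero    = begin
  ℕ→ℚ (rStirling₁ (suc n) 0 m)                   ≡⟨ cong ℕ→ℚ (rStirling₁-suc-zero m n) ⟩
  ℕ→ℚ ((m ℕ.+ n) ℕ.* rStirling₁ n 0 m)            ≡⟨ ℕ→ℚ-homo-* (m ℕ.+ n) (rStirling₁ n 0 m) ⟩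
  ℕ→ℚ (m ℕ.+ n) * ℕ→ℚ (rStirling₁ n 0 m)          ≡⟨ cong₂ _*_ (ℕ→ℚ-homo-+ m n) (rStirling₁≡risingCoeff m n 0) ⟩
  (ℕ→ℚ m + ℕ→ℚ n) * risingCoeff n 0 (ℕ→ℚ m)      ∎
rStirling₁≡risingCoeff m (suc n) (suc k) = begin
  ℕ→ℚ (rStirling₁ (suc n) (suc k) m)
    ≡⟨ cong ℕ→ℚ (rStirling₁-suc-suc m n k) ⟩
  ℕ→ℚ (rStirling₁ n k m ℕ.+ (m ℕ.+ n) ℕ.* rStirling₁ n (suc k) m)
    ≡⟨ trans (ℕ→ℚ-homo-+ (rStirling₁ n k m) _) (cong (λ t → ℕ→ℚ (rStirling₁ n k m) + t) (ℕ→ℚ-homo-* (m ℕ.+ n) _)) ⟩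
  ℕ→ℚ (rStirling₁ n k m) + ℕ→ℚ (m ℕ.+ n) * ℕ→ℚ (rStirling₁ n (suc k) m)
    ≡⟨ cong₂ _+_ (rStirling₁≡risingCoeff m n k) (cong₂ _*_ (ℕ→ℚ-homo-+ m n) (rStirling₁≡risingCoeff m n (suc k))) ⟩
  risingCoeff n k (ℕ→ℚ m) + (ℕ→ℚ m + ℕ→ℚ n) * risingCoeff n (suc k) (ℕ→ℚ m) ∎

rising : ℚ → ℕ → ℚ
rising s zero    = 1ℚ
rising s (suc N) = (s + ℕ→ℚ N) * rising s N

-- rising′ and rising″ are the first and second derivatives of rising in s.
rising′ : ℚ → ℕ → ℚ
rising′ s zero    = 0ℚ
rising′ s (suc N) = (s + ℕ→ℚ N) * rising′ s N + rising s N

rising″ : ℚ → ℕ → ℚ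
rising″ s zero    = 0ℚ
rising″ s (suc N) = (s + ℕ→ℚ N) * rising″ s N + ℕ→ℚ 2 * rising′ s N

rising-suc-factor : ∀ s N → rising s (suc N) ≡ s * rising (s + 1ℚ) N
rising-suc-factor s zero    = base s
  where
  base : ∀ s → (s + 0ℚ) * 1ℚ ≡ s * 1ℚ
  base = solve-∀ ℚ-ring
rising-suc-factor s (suc N) = begin
  (s + ℕ→ℚ (suc N)) * rising s (suc N)          ≡⟨ cong₂ (λ n a → (s + n) * a) (ℕ→ℚ-suc N) (rising-suc-factor s N) ⟩
  (s + (1ℚ + ℕ→ℚ N)) * (s * rising (s + 1ℚ) N)  ≡⟨ regroup s (ℕ→ℚ N) (rising (s + 1ℚ) N) ⟩
  s * ((s + 1ℚ + ℕ→ℚ N) * rising (s + 1ℚ) N)    ∎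
  where
  regroup : ∀ s n a → (s + (1ℚ + n)) * (s * a) ≡ s * ((s + 1ℚ + n) * a)
  regroup = solve-∀ ℚ-ring

rising′-suc-factor : ∀ s N → rising′ s (suc N) ≡ s * rising′ (s + 1ℚ) N + rising (s + 1ℚ) N
rising′-suc-factor s zero    = base s
  where
  base : ∀ s → (s + 0ℚ) * 0ℚ + 1ℚ ≡ s * 0ℚ + 1ℚ
  base = solve-∀ ℚ-ring
rising′-suc-factor s (suc N) = begin
  (s + ℕ→ℚ (suc N)) * rising′ s (suc N) + rising s (suc N)
    ≡⟨ cong₃ (ℕ→ℚ-suc N) (rising′-suc-factor s N) (rising-suc-factor s N) ⟩
  (s + (1ℚ + ℕ→ℚ N)) * (s * B + A) + s * A
    ≡⟨ regroup s (ℕ→ℚ N) B A ⟩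
  s * ((s + 1ℚ + ℕ→ℚ N) * B + A) + (s + 1ℚ + ℕ→ℚ N) * A ∎
  where
  A = rising (s + 1ℚ) N
  B = rising′ (s + 1ℚ) N
  cong₃ : ∀ {n n′ b b′ a a′} → n ≡ n′ → b ≡ b′ → a ≡ a′ → (s + n) * b + a ≡ (s + n′) * b′ + a′
  cong₃ refl refl refl = refl
  regroup : ∀ s n b a → (s + (1ℚ + n)) * (s * b + a) + s * a ≡ s * ((s + 1ℚ + n) * b + a) + (s + 1ℚ + n) * a
  regroup = solve-∀ ℚ-ring

rising″-suc-factor : ∀ s N → rising″ s (suc N) ≡ s * rising″ (s + 1ℚ) N + ℕ→ℚ 2 * rising′ (s + 1ℚ) N
rising″-suc-factor s zero    = base s
  where
  base : ∀ s → (s + 0ℚ) * 0ℚ + ℕ→ℚ 2 * 0ℚ ≡ s * 0ℚ + ℕ→ℚ 2 * 0ℚ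
  base = solve-∀ ℚ-ring
rising″-suc-factor s (suc N) = begin
  (s + ℕ→ℚ (suc N)) * rising″ s (suc N) + ℕ→ℚ 2 * rising′ s (suc N)
    ≡⟨ cong₃ (ℕ→ℚ-suc N) (rising″-suc-factor s N) (rising′-suc-factor s N) ⟩
  (s + (1ℚ + ℕ→ℚ N)) * (s * D + ℕ→ℚ 2 * B) + ℕ→ℚ 2 * (s * B + A)
    ≡⟨ regroup s (ℕ→ℚ N) D B A ⟩
  s * ((s + 1ℚ + ℕ→ℚ N) * D + ℕ→ℚ 2 * B) + ℕ→ℚ 2 * ((s + 1ℚ + ℕ→ℚ N) * B + A) ∎
  where
  A = rising (s + 1ℚ) N
  B = rising′ (s + 1ℚ) N
  D = rising″ (s + 1ℚ) N
  cong₃ : ∀ {n n′ d d′ b b′} → n ≡ n′ → d ≡ d′ → b ≡ b′ → (s + n) * d + ℕ→ℚ 2 * b ≡ (s + n′) * d′ + ℕ→ℚ 2 * b′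
  cong₃ refl refl refl = refl
  regroup : ∀ s n d b a → (s + (1ℚ + n)) * (s * d + ℕ→ℚ 2 * b) + ℕ→ℚ 2 * (s * b + a)
                        ≡ s * ((s + 1ℚ + n) * d + ℕ→ℚ 2 * b) + ℕ→ℚ 2 * ((s + 1ℚ + n) * b + a)
  regroup = solve-∀ ℚ-ring

rising″-pascal : ∀ s N → rising″ (s + 1ℚ) (suc N) ≡ rising″ s (suc N) + ℕ→ℚ (suc N) * rising″ (s + 1ℚ) N
rising″-pascal s N = begin
  (s + 1ℚ + ℕ→ℚ N) * D + ℕ→ℚ 2 * B         ≡⟨ regroup s (ℕ→ℚ N) D B ⟩
  (s * D + ℕ→ℚ 2 * B) + (1ℚ + ℕ→ℚ N) * D   ≡⟨ cong₂ (λ a n → a + n * D) (rising″-suc-factor s N) (ℕ→ℚ-suc N) ⟨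
  rising″ s (suc N) + ℕ→ℚ (suc N) * D      ∎
  where
  B = rising′ (s + 1ℚ) N
  D = rising″ (s + 1ℚ) N
  regroup : ∀ s n d b → (s + 1ℚ + n) * d + ℕ→ℚ 2 * b ≡ (s * d + ℕ→ℚ 2 * b) + (1ℚ + n) * d
  regroup = solve-∀ ℚ-ring

rising-0 : ∀ N → rising 0ℚ (suc N) ≡ 0ℚ
rising-0 N = trans (rising-suc-factor 0ℚ N) (*-zeroˡ (rising (0ℚ + 1ℚ) N))

rising′-0 : ∀ N → rising′ 0ℚ (suc N) ≡ ℕ→ℚ (N !)
rising′-0 zero    = refl
rising′-0 (suc N) = begin
  (0ℚ + ℕ→ℚ (suc N)) * rising′ 0ℚ (suc N) + rising 0ℚ (suc N)
    ≡⟨ cong₂ (λ b a → (0ℚ + ℕ→ℚ (suc N)) * b + a) (rising′-0 N) (rising-0 N) ⟩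
  (0ℚ + ℕ→ℚ (suc N)) * ℕ→ℚ (N !) + 0ℚ
    ≡⟨ simplify (ℕ→ℚ (suc N)) (ℕ→ℚ (N !)) ⟩
  ℕ→ℚ (suc N) * ℕ→ℚ (N !)
    ≡⟨ ℕ→ℚ-homo-* (suc N) (N !) ⟨
  ℕ→ℚ (suc N !) ∎
  where
  simplify : ∀ a f → (0ℚ + a) * f + 0ℚ ≡ a * f
  simplify = solve-∀ ℚ-ring

rising″-0 : ∀ N → rising″ 0ℚ (suc N) ≡ ℕ→ℚ 2 * ℕ→ℚ (N !) * harmonic N
rising″-0 zero    = refl
rising″-0 (suc N) = begin
  (0ℚ + ℕ→ℚ (suc N)) * rising″ 0ℚ (suc N) + ℕ→ℚ 2 * rising′ 0ℚ (suc N)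
    ≡⟨ cong₂ (λ d b → (0ℚ + ℕ→ℚ (suc N)) * d + ℕ→ℚ 2 * b) (rising″-0 N) (rising′-0 N) ⟩
  (0ℚ + ℕ→ℚ (suc N)) * (ℕ→ℚ 2 * ℕ→ℚ (N !) * harmonic N) + ℕ→ℚ 2 * ℕ→ℚ (N !)
    ≡⟨ regroup (ℕ→ℚ (suc N)) (ℕ→ℚ (N !)) (harmonic N) (+ 1 / suc N) ⟩
  ℕ→ℚ 2 * (ℕ→ℚ (suc N) * ℕ→ℚ (N !)) * (harmonic N + + 1 / suc N) + ℕ→ℚ 2 * ℕ→ℚ (N !) * (1ℚ + (- (ℕ→ℚ (suc N) * (+ 1 / suc N))))
    ≡⟨ cong₂ (λ a b → ℕ→ℚ 2 * a * harmonic (suc N) + ℕ→ℚ 2 * ℕ→ℚ (N !) * (1ℚ + (- b)))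
             (sym (ℕ→ℚ-homo-* (suc N) (N !))) (n*[1/n]≡1 (suc N)) ⟩
  ℕ→ℚ 2 * ℕ→ℚ (suc N !) * harmonic (suc N) + ℕ→ℚ 2 * ℕ→ℚ (N !) * (1ℚ + (- 1ℚ))
    ≡⟨ drop (ℕ→ℚ 2 * ℕ→ℚ (suc N !) * harmonic (suc N)) (ℕ→ℚ 2 * ℕ→ℚ (N !)) ⟩
  ℕ→ℚ 2 * ℕ→ℚ (suc N !) * harmonic (suc N) ∎
  where
  regroup : ∀ a f h i → (0ℚ + a) * (ℕ→ℚ 2 * f * h) + ℕ→ℚ 2 * f ≡ ℕ→ℚ 2 * (a * f) * (h + i) + ℕ→ℚ 2 * f * (1ℚ + (- (a * i)))
  regroup = solve-∀ ℚ-ring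
  drop : ∀ a b → a + b * (1ℚ + (- 1ℚ)) ≡ a
  drop = solve-∀ ℚ-ring

applyRising-pow : ∀ t M N → applyRising (t ^ℚ_) M N 0 ≡ rising (M + t) N
applyRising-pow t M zero    = refl
applyRising-pow t M (suc N) = begin
  (M + ℕ→ℚ N) * P + applyRising (t ^ℚ_) M N 1
    ≡⟨ cong (λ a → (M + ℕ→ℚ N) * P + a) (applyRising-suc M t (λ j → sym (+-identityʳ (t * t ^ℚ j))) N 0) ⟩
  (M + ℕ→ℚ N) * P + (t * P + applyRising (λ _ → 0ℚ) M N 0)
    ≡⟨ cong₂ (λ p z → (M + ℕ→ℚ N) * p + (t * p + z)) (applyRising-pow t M N) (applyRising-zero M N 0) ⟩
  (M + ℕ→ℚ N) * rising (M + t) N + (t * rising (M + t) N + 0ℚ)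
    ≡⟨ regroup M (ℕ→ℚ N) t (rising (M + t) N) ⟩
  (M + t + ℕ→ℚ N) * rising (M + t) N ∎
  where
  P = applyRising (t ^ℚ_) M N 0
  regroup : ∀ m n t a → (m + n) * a + (t * a + 0ℚ) ≡ (m + t + n) * a
  regroup = solve-∀ ℚ-ring

applyRising-∂pow : ∀ t M N → applyRising (∂pow t) M N 0 ≡ rising′ (M + t) N
applyRising-∂pow t M zero    = refl
applyRising-∂pow t M (suc N) = begin
  (M + ℕ→ℚ N) * P + applyRising (∂pow t) M N 1
    ≡⟨ cong (λ a → (M + ℕ→ℚ N) * P + a) (applyRising-suc M t (λ j → refl) N 0) ⟩
  (M + ℕ→ℚ N) * P + (t * P + applyRising (t ^ℚ_) M N 0)
    ≡⟨ cong₂ (λ p q → (M + ℕ→ℚ N) * p + (t * p + q)) (applyRising-∂pow t M N) (applyRising-pow t M N) ⟩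
  (M + ℕ→ℚ N) * rising′ (M + t) N + (t * rising′ (M + t) N + rising (M + t) N)
    ≡⟨ regroup M (ℕ→ℚ N) t (rising′ (M + t) N) (rising (M + t) N) ⟩
  (M + t + ℕ→ℚ N) * rising′ (M + t) N + rising (M + t) N ∎
  where
  P = applyRising (∂pow t) M N 0
  regroup : ∀ m n t b a → (m + n) * b + (t * b + a) ≡ (m + t + n) * b + a
  regroup = solve-∀ ℚ-ring

applyRising-∂²pow : ∀ t M N → applyRising (∂²pow t) M N 0 ≡ rising″ (M + t) N
applyRising-∂²pow t M zero    = refl
applyRising-∂²pow t M (suc N) = begin
  (M + ℕ→ℚ N) * P + applyRising (∂²pow t) M N 1
    ≡⟨ cong (λ a → (M + ℕ→ℚ N) * P + a) (applyRising-suc M t (λ j → refl) N 0) ⟩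
  (M + ℕ→ℚ N) * P + (t * P + applyRising (λ j → ℕ→ℚ 2 * ∂pow t j) M N 0)
    ≡⟨ cong (λ a → (M + ℕ→ℚ N) * P + (t * P + a)) (applyRising-scale M (ℕ→ℚ 2) (λ j → refl) N 0) ⟩
  (M + ℕ→ℚ N) * P + (t * P + ℕ→ℚ 2 * applyRising (∂pow t) M N 0)
    ≡⟨ cong₂ (λ p q → (M + ℕ→ℚ N) * p + (t * p + ℕ→ℚ 2 * q)) (applyRising-∂²pow t M N) (applyRising-∂pow t M N) ⟩
  (M + ℕ→ℚ N) * rising″ (M + t) N + (t * rising″ (M + t) N + ℕ→ℚ 2 * rising′ (M + t) N)
    ≡⟨ regroup M (ℕ→ℚ N) t (rising″ (M + t) N) (rising′ (M + t) N) ⟩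
  (M + t + ℕ→ℚ N) * rising″ (M + t) N + ℕ→ℚ 2 * rising′ (M + t) N ∎
  where
  P = applyRising (∂²pow t) M N 0
  regroup : ∀ m n t d b → (m + n) * d + (t * d + ℕ→ℚ 2 * b) ≡ (m + t + n) * d + ℕ→ℚ 2 * b
  regroup = solve-∀ ℚ-ring

applyRising-bernoulliWeight : ∀ y M N → ℕ→ℚ (suc N) * applyRising (bernoulliWeight y) M N 0 ≡ rising″ (M + (- y)) (suc N)
applyRising-bernoulliWeight y M N = begin
  ℕ→ℚ (suc N) * applyRising (bernoulliWeight y) M N 0
    ≡⟨ cong (λ m → ℕ→ℚ (suc N) * applyRising (bernoulliWeight y) m N 0) (shift M) ⟩
  ℕ→ℚ (suc N) * applyRising (bernoulliWeight y) (M′ + 1ℚ) N 0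
    ≡⟨ raised ⟩
  applyRising (∂²pow (- y)) (M′ + 1ℚ) (suc N) 0
    ≡⟨ cong (λ m → applyRising (∂²pow (- y)) m (suc N) 0) (shift M) ⟨
  applyRising (∂²pow (- y)) M (suc N) 0
    ≡⟨ applyRising-∂²pow (- y) M (suc N) ⟩
  rising″ (M + (- y)) (suc N) ∎
  where
  M′ = M + (- 1ℚ)
  shift : ∀ m → m ≡ (m + (- 1ℚ)) + 1ℚ
  shift = solve-∀ ℚ-ring
  Q = applyRising (bernoulliWeight y) M′ (suc N) 0
  E = applyRising (bernoulliWeight y) (M′ + 1ℚ) N 0
  R = applyRising (bernoulliWeight (y + 1ℚ)) (M′ + 1ℚ) (suc N) 0
  D = applyRising (∂²pow (- y)) (M′ + 1ℚ) (suc N) 0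
  raised : ℕ→ℚ (suc N) * E ≡ D
  raised = begin
    ℕ→ℚ (suc N) * E
      ≡⟨ add-sub Q (ℕ→ℚ (suc N) * E) ⟩
    (Q + ℕ→ℚ (suc N) * E) + (- Q)
      ≡⟨ cong₂ (λ a b → a + (- b)) (sym (applyRising-pascal (bernoulliWeight y) M′ N 0))
                                  (applyRising-shift M′ (bernoulliWeight-shift y) (suc N) 0) ⟩
    applyRising (bernoulliWeight y) (M′ + 1ℚ) (suc N) 0 + (- (1ℚ * R))
      ≡⟨ cong (λ a → a + (- (1ℚ * R))) (applyRising-+ (M′ + 1ℚ) (bernoulliWeight-difference y) (suc N) 0) ⟩
    (R + D) + (- (1ℚ * R))
      ≡⟨ cancel R D ⟩
    D ∎
    where
    add-sub : ∀ q e → e ≡ (q + e) + (- q)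
    add-sub = solve-∀ ℚ-ring
    cancel : ∀ r d → (r + d) + (- (1ℚ * r)) ≡ d
    cancel = solve-∀ ℚ-ring

-- Hyperharmonic numbers

risingℤ≡rising : ∀ r m → ℤ→ℚ (risingℤ r m) ≡ rising (ℤ→ℚ r) m
risingℤ≡rising r zero    = refl
risingℤ≡rising r (suc m) = begin
  ℤ→ℚ (risingℤ r m ℤ.* (r ℤ.+ + m))          ≡⟨ ℤ→ℚ-homo-* (risingℤ r m) (r ℤ.+ + m) ⟩
  ℤ→ℚ (risingℤ r m) * ℤ→ℚ (r ℤ.+ + m)        ≡⟨ cong₂ _*_ (risingℤ≡rising r m) (ℤ→ℚ-homo-+ r (+ m)) ⟩
  rising (ℤ→ℚ r) m * (ℤ→ℚ r + ℕ→ℚ m)         ≡⟨ *-comm (rising (ℤ→ℚ r) m) _ ⟩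
  (ℤ→ℚ r + ℕ→ℚ m) * rising (ℤ→ℚ r) m         ∎

m!*negBinomCoeff≡rising : ∀ r m → ℕ→ℚ (m !) * negBinomCoeff r m ≡ rising (ℤ→ℚ r) m
m!*negBinomCoeff≡rising r m = trans (n*[z/n]≡z (risingℤ r m) (m !) {{m !≢0}}) (risingℤ≡rising r m)

negBinomCoeff-pascal : ∀ R m → negBinomCoeff (ℤ.suc R) (suc m) ≡ negBinomCoeff (ℤ.suc R) m + negBinomCoeff R (suc m)
negBinomCoeff-pascal R m = ℕ→ℚ-*-cancelˡ (suc m !) {{suc m !≢0}} (begin
  ℕ→ℚ (suc m !) * negBinomCoeff (ℤ.suc R) (suc m)
    ≡⟨ m!*negBinomCoeff≡rising (ℤ.suc R) (suc m) ⟩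
  rising (ℤ→ℚ (ℤ.suc R)) (suc m)
    ≡⟨ cong (λ s → rising s (suc m)) (ℤ→ℚ-suc R) ⟩
  (s + 1ℚ + ℕ→ℚ m) * A
    ≡⟨ regroup s (ℕ→ℚ m) A ⟩
  (1ℚ + ℕ→ℚ m) * A + s * A
    ≡⟨ cong₂ (λ n a → n * A + a) (ℕ→ℚ-suc m) (rising-suc-factor s m) ⟨
  ℕ→ℚ (suc m) * A + rising s (suc m)
    ≡⟨ cong₂ (λ a b → ℕ→ℚ (suc m) * a + b)
         (sym (trans (m!*negBinomCoeff≡rising (ℤ.suc R) m) (cong (λ s → rising s m) (ℤ→ℚ-suc R))))
         (sym (m!*negBinomCoeff≡rising R (suc m))) ⟩
  ℕ→ℚ (suc m) * (ℕ→ℚ (m !) * negBinomCoeff (ℤ.suc R) m) + ℕ→ℚ (suc m !) * negBinomCoeff R (suc m)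
    ≡⟨ cong (_+ ℕ→ℚ (suc m !) * negBinomCoeff R (suc m))
         (trans (sym (*-assoc (ℕ→ℚ (suc m)) (ℕ→ℚ (m !)) _)) (cong (_* negBinomCoeff (ℤ.suc R) m) (sym (ℕ→ℚ-homo-* (suc m) (m !))))) ⟩
  ℕ→ℚ (suc m !) * negBinomCoeff (ℤ.suc R) m + ℕ→ℚ (suc m !) * negBinomCoeff R (suc m)
    ≡⟨ *-distribˡ-+ (ℕ→ℚ (suc m !)) _ _ ⟨
  ℕ→ℚ (suc m !) * (negBinomCoeff (ℤ.suc R) m + negBinomCoeff R (suc m)) ∎)
  where
  s = ℤ→ℚ R
  A = rising (s + 1ℚ) m
  regroup : ∀ s n a → (s + 1ℚ + n) * a ≡ (1ℚ + n) * a + s * a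
  regroup = solve-∀ ℚ-ring

negBinomCoeff-0 : ∀ m → negBinomCoeff (+ 0) (suc m) ≡ 0ℚ
negBinomCoeff-0 m = ℕ→ℚ-*-cancelˡ (suc m !) {{suc m !≢0}}
  (trans (m!*negBinomCoeff≡rising (+ 0) (suc m)) (trans (rising-0 m) (sym (*-zeroʳ (ℕ→ℚ (suc m !))))))

recip : ℕ → ℚ
recip j = + 1 / suc (j ∸ 1)

hyper-pascal : ∀ R k → hyper (ℤ.suc R) (suc k) ≡ hyper (ℤ.suc R) k + hyper R (suc k)
hyper-pascal R k = begin
  Σ₁ k (λ j → recip j * negBinomCoeff R′ (suc k ∸ j)) + recip (suc k) * negBinomCoeff R′ (k ∸ k)
    ≡⟨ cong₂ (λ a e → a + recip (suc k) * negBinomCoeff R′ e) (Σ₁-cong-< k split) (ℕP.n∸n≡0 k) ⟩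
  Σ₁ k (λ j → recip j * negBinomCoeff R′ (k ∸ j) + recip j * negBinomCoeff R (suc k ∸ j)) + recip (suc k) * 1ℚ
    ≡⟨ cong (_+ recip (suc k) * 1ℚ) (Σ₁-distrib-+ k _ _) ⟩
  (hyper R′ k + Σ₁ k (λ j → recip j * negBinomCoeff R (suc k ∸ j))) + recip (suc k) * 1ℚ
    ≡⟨ +-assoc (hyper R′ k) _ _ ⟩
  hyper R′ k + (Σ₁ k (λ j → recip j * negBinomCoeff R (suc k ∸ j)) + recip (suc k) * 1ℚ)
    ≡⟨ cong (λ e → hyper R′ k + (Σ₁ k (λ j → recip j * negBinomCoeff R (suc k ∸ j)) + recip (suc k) * negBinomCoeff R e)) (ℕP.n∸n≡0 k) ⟨
  hyper R′ k + hyper R (suc k) ∎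
  where
  R′ = ℤ.suc R
  split : ∀ j → j ℕ.< k → recip (suc j) * negBinomCoeff R′ (suc k ∸ suc j)
                        ≡ recip (suc j) * negBinomCoeff R′ (k ∸ suc j) + recip (suc j) * negBinomCoeff R (suc k ∸ suc j)
  split j j<k rewrite ℕP.+-∸-assoc 1 j<k =
    trans (cong (recip (suc j) *_) (negBinomCoeff-pascal R (k ∸ suc j))) (*-distribˡ-+ (recip (suc j)) _ _)

hyper-0 : ∀ k → hyper (+ 0) (suc k) ≡ recip (suc k)
hyper-0 k = begin
  Σ₁ k (λ j → recip j * negBinomCoeff (+ 0) (suc k ∸ j)) + recip (suc k) * negBinomCoeff (+ 0) (k ∸ k)
    ≡⟨ cong₂ (λ a e → a + recip (suc k) * negBinomCoeff (+ 0) e) (trans (Σ₁-cong-< k vanishes) (Σ₁-zero k)) (ℕP.n∸n≡0 k) ⟩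
  0ℚ + recip (suc k) * 1ℚ
    ≡⟨ trans (+-identityˡ _) (*-identityʳ _) ⟩
  recip (suc k) ∎
  where
  vanishes : ∀ j → j ℕ.< k → recip (suc j) * negBinomCoeff (+ 0) (suc k ∸ suc j) ≡ 0ℚ
  vanishes j j<k rewrite ℕP.+-∸-assoc 1 j<k = trans (cong (recip (suc j) *_) (negBinomCoeff-0 (k ∸ suc j))) (*-zeroʳ (recip (suc j)))

-- Convolutions of hyperharmonic numbers

hyperConv : ℕ → ℤ → ℤ → ℚ
hyperConv N A B = Σ₁ N (λ k → hyper A k * hyper B (suc N ∸ k))

hyperConv-pascalˡ : ∀ N A B → hyperConv (suc N) (ℤ.suc A) B ≡ hyperConv N (ℤ.suc A) B + hyperConv (suc N) A B
hyperConv-pascalˡ N A B = begin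
  Σ₁ (suc N) (λ k → hyper A′ k * hyper B (suc (suc N) ∸ k))
    ≡⟨ Σ₁-cong-< (suc N) (λ k _ → trans (cong (_* hyper B (suc N ∸ k)) (hyper-pascal A k))
                                        (*-distribʳ-+ (hyper B (suc N ∸ k)) (hyper A′ k) (hyper A (suc k)))) ⟩
  Σ₁ (suc N) (λ k → hyper A′ (k ∸ 1) * hyper B (suc (suc N) ∸ k) + hyper A k * hyper B (suc (suc N) ∸ k))
    ≡⟨ Σ₁-distrib-+ (suc N) _ _ ⟩
  Σ₁ (suc N) (λ k → hyper A′ (k ∸ 1) * hyper B (suc (suc N) ∸ k)) + hyperConv (suc N) A B
    ≡⟨ cong (_+ hyperConv (suc N) A B) (Σ₁-unfoldˡ N (λ k → hyper A′ (k ∸ 1) * hyper B (suc (suc N) ∸ k))) ⟩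
  (0ℚ * hyper B (suc N) + hyperConv N A′ B) + hyperConv (suc N) A B
    ≡⟨ cong (_+ hyperConv (suc N) A B) (drop (hyper B (suc N)) (hyperConv N A′ B)) ⟩
  hyperConv N A′ B + hyperConv (suc N) A B ∎
  where
  A′ = ℤ.suc A
  drop : ∀ h c → 0ℚ * h + c ≡ c
  drop = solve-∀ ℚ-ring

hyperConv-pascalʳ : ∀ N A B → hyperConv (suc N) A (ℤ.suc B) ≡ hyperConv N A (ℤ.suc B) + hyperConv (suc N) A B
hyperConv-pascalʳ N A B = begin
  Σ₁ (suc N) (λ k → hyper A k * hyper B′ (suc (suc N) ∸ k))
    ≡⟨ Σ₁-cong-< (suc N) split ⟩
  Σ₁ (suc N) (λ k → hyper A k * hyper B′ (suc N ∸ k) + hyper A k * hyper B (suc (suc N) ∸ k))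
    ≡⟨ Σ₁-distrib-+ (suc N) _ _ ⟩
  (hyperConv N A B′ + hyper A (suc N) * hyper B′ (N ∸ N)) + hyperConv (suc N) A B
    ≡⟨ cong (λ e → (hyperConv N A B′ + hyper A (suc N) * hyper B′ e) + hyperConv (suc N) A B) (ℕP.n∸n≡0 N) ⟩
  (hyperConv N A B′ + hyper A (suc N) * 0ℚ) + hyperConv (suc N) A B
    ≡⟨ cong (_+ hyperConv (suc N) A B) (drop (hyperConv N A B′) (hyper A (suc N))) ⟩
  hyperConv N A B′ + hyperConv (suc N) A B ∎
  where
  B′ = ℤ.suc B
  drop : ∀ c h → c + h * 0ℚ ≡ c
  drop = solve-∀ ℚ-ring
  split : ∀ k → k ℕ.< suc N → hyper A (suc k) * hyper B′ (suc N ∸ k)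
                            ≡ hyper A (suc k) * hyper B′ (N ∸ k) + hyper A (suc k) * hyper B (suc N ∸ k)
  split k (s≤s k≤N) rewrite ℕP.+-∸-assoc 1 k≤N =
    trans (cong (hyper A (suc k) *_) (hyper-pascal B (N ∸ k))) (*-distribˡ-+ (hyper A (suc k)) _ _)

hyperConv-transfer : ∀ N A B → hyperConv N (ℤ.suc A) B ≡ hyperConv N A (ℤ.suc B)
hyperConv-transfer zero    A B = refl
hyperConv-transfer (suc N) A B = begin
  hyperConv (suc N) (ℤ.suc A) B                     ≡⟨ hyperConv-pascalˡ N A B ⟩
  hyperConv N (ℤ.suc A) B + hyperConv (suc N) A B   ≡⟨ cong (_+ hyperConv (suc N) A B) (hyperConv-transfer N A B) ⟩
  hyperConv N A (ℤ.suc B) + hyperConv (suc N) A B   ≡⟨ hyperConv-pascalʳ N A B ⟨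
  hyperConv (suc N) A (ℤ.suc B)                     ∎

hyperConv-collect : ∀ N A s → hyperConv N A (+ s) ≡ hyperConv N (A ℤ.+ + s) (+ 0)
hyperConv-collect N A zero    = cong (λ a → hyperConv N a (+ 0)) (sym (ℤP.+-identityʳ A))
hyperConv-collect N A (suc s) = begin
  hyperConv N A (ℤ.suc (+ s))             ≡⟨ hyperConv-transfer N A (+ s) ⟨
  hyperConv N (ℤ.suc A) (+ s)             ≡⟨ hyperConv-collect N (ℤ.suc A) s ⟩
  hyperConv N (ℤ.suc A ℤ.+ + s) (+ 0)     ≡⟨ cong (λ a → hyperConv N (a ℤ.+ + s) (+ 0)) (ℤP.+-comm (+ 1) A) ⟩
  hyperConv N (A ℤ.+ + 1 ℤ.+ + s) (+ 0)   ≡⟨ cong (λ a → hyperConv N a (+ 0)) (ℤP.+-assoc A (+ 1) (+ s)) ⟩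
  hyperConv N (A ℤ.+ + suc s) (+ 0)       ∎

partial-fractions : ∀ a b a⁻¹ b⁻¹ c⁻¹ → a * a⁻¹ ≡ 1ℚ → b * b⁻¹ ≡ 1ℚ → (a + b) * c⁻¹ ≡ 1ℚ →
  a⁻¹ * b⁻¹ ≡ c⁻¹ * (a⁻¹ + b⁻¹)
partial-fractions a b a⁻¹ b⁻¹ c⁻¹ aa⁻¹≡1 bb⁻¹≡1 cc⁻¹≡1 = begin
  a⁻¹ * b⁻¹                                      ≡⟨ *-identityˡ (a⁻¹ * b⁻¹) ⟨
  1ℚ * (a⁻¹ * b⁻¹)                               ≡⟨ cong (_* (a⁻¹ * b⁻¹)) cc⁻¹≡1 ⟨
  (a + b) * c⁻¹ * (a⁻¹ * b⁻¹)                    ≡⟨ expand a b a⁻¹ b⁻¹ c⁻¹ ⟩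
  c⁻¹ * (a⁻¹ * (b * b⁻¹) + b⁻¹ * (a * a⁻¹))      ≡⟨ cong₂ (λ x y → c⁻¹ * (a⁻¹ * x + b⁻¹ * y)) bb⁻¹≡1 aa⁻¹≡1 ⟩
  c⁻¹ * (a⁻¹ * 1ℚ + b⁻¹ * 1ℚ)                    ≡⟨ cong₂ (λ x y → c⁻¹ * (x + y)) (*-identityʳ a⁻¹) (*-identityʳ b⁻¹) ⟩
  c⁻¹ * (a⁻¹ + b⁻¹)                              ∎
  where
  expand : ∀ a b x y z → (a + b) * z * (x * y) ≡ z * (x * (b * y) + y * (a * x))
  expand = solve-∀ ℚ-ring

hyperConv-0-0 : ∀ N → hyperConv N (+ 0) (+ 0) ≡ ℕ→ℚ 2 * (harmonic N * (+ 1 / suc N))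
hyperConv-0-0 N = begin
  Σ₁ N (λ k → hyper (+ 0) k * hyper (+ 0) (suc N ∸ k))   ≡⟨ Σ₁-cong-< N split ⟩
  Σ₁ N (λ k → I * (recip k + recip (suc N ∸ k)))          ≡⟨ Σ₁-*-distribˡ N I _ ⟩
  I * Σ₁ N (λ k → recip k + recip (suc N ∸ k))            ≡⟨ cong (I *_) (Σ₁-distrib-+ N recip (λ k → recip (suc N ∸ k))) ⟩
  I * (harmonic N + Σ₁ N (λ k → recip (suc N ∸ k)))       ≡⟨ cong (λ s → I * (harmonic N + s)) (Σ₁-reverse N recip) ⟨
  I * (harmonic N + harmonic N)                          ≡⟨ double I (harmonic N) ⟩
  ℕ→ℚ 2 * (harmonic N * I)                               ∎
  where
  I = + 1 / suc N
  double : ∀ i h → i * (h + h) ≡ ℕ→ℚ 2 * (h * i)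
  double = solve-∀ ℚ-ring
  split : ∀ j → j ℕ.< N → hyper (+ 0) (suc j) * hyper (+ 0) (suc N ∸ suc j) ≡ I * (recip (suc j) + recip (suc N ∸ suc j))
  split j j<N rewrite ℕP.+-∸-assoc 1 j<N =
    trans (cong₂ _*_ (hyper-0 j) (hyper-0 (N ∸ suc j)))
          (partial-fractions (ℕ→ℚ (suc j)) (ℕ→ℚ (suc (N ∸ suc j))) (recip (suc j)) (recip (suc (N ∸ suc j))) I
             (n*[1/n]≡1 (suc j)) (n*[1/n]≡1 (suc (N ∸ suc j))) sum-inverse)
    where
    sum-inverse : (ℕ→ℚ (suc j) + ℕ→ℚ (suc (N ∸ suc j))) * I ≡ 1ℚ
    sum-inverse = trans (cong (_* I) (trans (sym (ℕ→ℚ-homo-+ (suc j) (suc (N ∸ suc j))))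
                                            (cong (λ n → ℕ→ℚ (suc n)) (trans (ℕP.+-suc j (N ∸ suc j)) (ℕP.m+[n∸m]≡n j<N)))))
                        (n*[1/n]≡1 (suc N))

Σ-C-sgn≡0 : ∀ N → Σ₀ (suc N) (λ j → C[ suc N , j ] * sgn j) ≡ 0ℚ
Σ-C-sgn≡0 N = begin
  Σ₀ (suc N) (λ j → C[ suc N , j ] * sgn j)      ≡⟨ Σ₀-pascal N sgn ⟩
  S + Σ₀ N (λ l → C[ N , l ] * sgn (suc l))       ≡⟨ cong (λ t → S + t) (Σ₀-cong N (λ l → sym (neg-distribʳ-* C[ N , l ] (sgn l)))) ⟩
  S + Σ₀ N (λ l → - (C[ N , l ] * sgn l))         ≡⟨ cong (λ t → S + t) (Σ₀-neg N (λ l → C[ N , l ] * sgn l)) ⟩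
  S + (- S)                                      ≡⟨ +-inverseʳ S ⟩
  0ℚ                                             ∎
  where
  S = Σ₀ N (λ l → C[ N , l ] * sgn l)

Σ-C-sgn/[1+l] : ∀ i → Σ₀ i (λ l → C[ i , l ] * sgn l * (+ 1 / suc l)) ≡ + 1 / suc i
Σ-C-sgn/[1+l] i = ℕ→ℚ-*-cancelˡ (suc i) (begin
  ℕ→ℚ (suc i) * Σ₀ i (λ l → C[ i , l ] * sgn l * (+ 1 / suc l))
    ≡⟨ trans (sym (Σ₀-*-distribˡ i (ℕ→ℚ (suc i)) _)) (Σ₀-cong i absorb) ⟩
  Σ₀ i (λ l → - (C[ suc i , suc l ] * sgn (suc l)))
    ≡⟨ trans (Σ₀-neg i _) (cong -_ (Σ₀-suc≡Σ₁ i (λ l → C[ suc i , l ] * sgn l))) ⟩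
  - Σ₁ (suc i) (λ l → C[ suc i , l ] * sgn l)
    ≡⟨ cong -_ tail-sum ⟩
  - (- 1ℚ)
    ≡⟨ n*[1/n]≡1 (suc i) ⟨
  ℕ→ℚ (suc i) * (+ 1 / suc i) ∎)
  where
  absorb : ∀ l → ℕ→ℚ (suc i) * (C[ i , l ] * sgn l * (+ 1 / suc l)) ≡ - (C[ suc i , suc l ] * sgn (suc l))
  absorb l = begin
    ℕ→ℚ (suc i) * (C[ i , l ] * sgn l * (+ 1 / suc l))
      ≡⟨ regroup (ℕ→ℚ (suc i)) C[ i , l ] (sgn l) (+ 1 / suc l) ⟩
    ℕ→ℚ (suc i) * (C[ i , l ] * (+ 1 / suc l)) * sgn l
      ≡⟨ cong (λ c → ℕ→ℚ (suc i) * c * sgn l) (C[]-absorb-inverse i l) ⟩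
    ℕ→ℚ (suc i) * ((+ 1 / suc i) * C[ suc i , suc l ]) * sgn l
      ≡⟨ cong (_* sgn l) (trans (sym (*-assoc (ℕ→ℚ (suc i)) (+ 1 / suc i) C[ suc i , suc l ]))
                                (cong (_* C[ suc i , suc l ]) (n*[1/n]≡1 (suc i)))) ⟩
    1ℚ * C[ suc i , suc l ] * sgn l
      ≡⟨ negate C[ suc i , suc l ] (sgn l) ⟩
    - (C[ suc i , suc l ] * sgn (suc l)) ∎
    where
    regroup : ∀ a b s c → a * (b * s * c) ≡ a * (b * c) * s
    regroup = solve-∀ ℚ-ring
    negate : ∀ b s → 1ℚ * b * s ≡ - (b * (- s))
    negate = solve-∀ ℚ-ring
  tail-sum : Σ₁ (suc i) (λ l → C[ suc i , l ] * sgn l) ≡ - 1ℚ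
  tail-sum = begin
    Σ₁ (suc i) (λ l → C[ suc i , l ] * sgn l)               ≡⟨ shift _ ⟩
    (1ℚ * 1ℚ + Σ₁ (suc i) (λ l → C[ suc i , l ] * sgn l)) + (- 1ℚ)
      ≡⟨ cong (_+ (- 1ℚ)) (trans (sym (Σ₀≡f0+Σ₁ (suc i) (λ l → C[ suc i , l ] * sgn l))) (Σ-C-sgn≡0 i)) ⟩
    0ℚ + (- 1ℚ)                                              ≡⟨ +-identityˡ (- 1ℚ) ⟩
    - 1ℚ                                                     ∎
    where
    shift : ∀ x → x ≡ (1ℚ * 1ℚ + x) + (- 1ℚ)
    shift = solve-∀ ℚ-ring

Σ-C-sgn-harmonic : ∀ i → Σ₁ (suc i) (λ j → C[ suc i , j ] * sgn (suc j) * harmonic j) ≡ + 1 / suc i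
Σ-C-sgn-harmonic i = begin
  Σ₁ (suc i) F                                        ≡⟨ add-zero (Σ₁ (suc i) F) (C[ suc i , 0 ] * sgn 1) ⟩
  F 0 + Σ₁ (suc i) F                                  ≡⟨ Σ₀≡f0+Σ₁ (suc i) F ⟨
  Σ₀ (suc i) F                                        ≡⟨ Σ₀-cong (suc i) (λ j → *-assoc C[ suc i , j ] (sgn (suc j)) (harmonic j)) ⟩
  Σ₀ (suc i) (λ j → C[ suc i , j ] * G j)             ≡⟨ Σ₀-pascal i G ⟩
  Σ₀ i (λ l → C[ i , l ] * G l) + Σ₀ i (λ l → C[ i , l ] * G (suc l))
                                                      ≡⟨ Σ₀-distrib-+ i _ _ ⟨
  Σ₀ i (λ l → C[ i , l ] * G l + C[ i , l ] * G (suc l))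
                                                      ≡⟨ Σ₀-cong i telescope ⟩
  Σ₀ i (λ l → C[ i , l ] * sgn l * (+ 1 / suc l))     ≡⟨ Σ-C-sgn/[1+l] i ⟩
  + 1 / suc i                                         ∎
  where
  F : ℕ → ℚ
  F j = C[ suc i , j ] * sgn (suc j) * harmonic j
  G : ℕ → ℚ
  G j = sgn (suc j) * harmonic j
  add-zero : ∀ x c → x ≡ c * 0ℚ + x
  add-zero = solve-∀ ℚ-ring
  telescope : ∀ l → C[ i , l ] * G l + C[ i , l ] * G (suc l) ≡ C[ i , l ] * sgn l * (+ 1 / suc l)
  telescope l = trans (cong (λ s → C[ i , l ] * G l + C[ i , l ] * (s * harmonic (suc l))) (sgn-suc-suc l))
                      (cancel C[ i , l ] (sgn l) (harmonic l) (+ 1 / suc l))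
    where
    cancel : ∀ b s h v → b * ((- s) * h) + b * (s * (h + v)) ≡ b * s * v
    cancel = solve-∀ ℚ-ring

Σ-C-sgn-harmonic≡harmonic : ∀ n → Σ₁ n (λ k → C[ suc n , suc k ] * sgn (suc k) * harmonic k) ≡ harmonic n
Σ-C-sgn-harmonic≡harmonic zero    = refl
Σ-C-sgn-harmonic≡harmonic (suc n) = begin
  Σ₁ (suc n) (λ k → C[ suc (suc n) , suc k ] * sgn (suc k) * harmonic k)
    ≡⟨ Σ₁-cong (suc n) (λ k → trans (cong (λ c → c * sgn (suc k) * harmonic k) (C[]-pascal (suc n) k))
                                   (expand C[ suc n , k ] C[ suc n , suc k ] (sgn (suc k)) (harmonic k))) ⟩
  Σ₁ (suc n) (λ k → C[ suc n , k ] * sgn (suc k) * harmonic k + C[ suc n , suc k ] * sgn (suc k) * harmonic k)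
    ≡⟨ Σ₁-distrib-+ (suc n) _ _ ⟩
  Σ₁ (suc n) (λ k → C[ suc n , k ] * sgn (suc k) * harmonic k)
    + (Σ₁ n (λ k → C[ suc n , suc k ] * sgn (suc k) * harmonic k) + C[ suc n , suc (suc n) ] * sgn (suc (suc n)) * harmonic (suc n))
    ≡⟨ cong₂ (λ a b → a + (b + C[ suc n , suc (suc n) ] * sgn (suc (suc n)) * harmonic (suc n)))
             (Σ-C-sgn-harmonic n) (Σ-C-sgn-harmonic≡harmonic n) ⟩
  + 1 / suc n + (harmonic n + C[ suc n , suc (suc n) ] * sgn (suc (suc n)) * harmonic (suc n))
    ≡⟨ cong (λ c → + 1 / suc n + (harmonic n + c * sgn (suc (suc n)) * harmonic (suc n))) (C[]-vanish (ℕP.n<1+n (suc n))) ⟩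
  + 1 / suc n + (harmonic n + 0ℚ * sgn (suc (suc n)) * harmonic (suc n))
    ≡⟨ simplify (+ 1 / suc n) (harmonic n) (sgn (suc (suc n))) (harmonic (suc n)) ⟩
  harmonic n + + 1 / suc n ∎
  where
  expand : ∀ a b s h → (a + b) * s * h ≡ a * s * h + b * s * h
  expand = solve-∀ ℚ-ring
  simplify : ∀ v h s h′ → v + (h + 0ℚ * s * h′) ≡ h + v
  simplify = solve-∀ ℚ-ring

harmonicBinomSum : ℕ → ℕ → ℚ
harmonicBinomSum n a = ℕ→ℚ 2 * Σ₁ n (λ k → C[ n ℕ.+ a , k ℕ.+ a ] * (sgn (suc k) * (+ 1 / suc k)) * harmonic k)

harmonicBinomSum-0 : ∀ N → harmonicBinomSum N 0 ≡ ℕ→ℚ 2 * (harmonic N * (+ 1 / suc N))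
harmonicBinomSum-0 N = cong (ℕ→ℚ 2 *_) (begin
  Σ₁ N (λ k → C[ N ℕ.+ 0 , k ℕ.+ 0 ] * (sgn (suc k) * (+ 1 / suc k)) * harmonic k)
    ≡⟨ Σ₁-cong N (λ k → cong₂ (λ a b → C[ a , b ] * (sgn (suc k) * (+ 1 / suc k)) * harmonic k) (ℕP.+-identityʳ N) (ℕP.+-identityʳ k)) ⟩
  Σ₁ N (λ k → C[ N , k ] * (sgn (suc k) * (+ 1 / suc k)) * harmonic k)
    ≡⟨ Σ₁-cong N absorb ⟩
  Σ₁ N (λ k → (+ 1 / suc N) * (C[ suc N , suc k ] * sgn (suc k) * harmonic k))
    ≡⟨ Σ₁-*-distribˡ N (+ 1 / suc N) _ ⟩
  (+ 1 / suc N) * Σ₁ N (λ k → C[ suc N , suc k ] * sgn (suc k) * harmonic k)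
    ≡⟨ cong ((+ 1 / suc N) *_) (Σ-C-sgn-harmonic≡harmonic N) ⟩
  (+ 1 / suc N) * harmonic N
    ≡⟨ *-comm (+ 1 / suc N) (harmonic N) ⟩
  harmonic N * (+ 1 / suc N) ∎)
  where
  absorb : ∀ k → C[ N , k ] * (sgn (suc k) * (+ 1 / suc k)) * harmonic k ≡ (+ 1 / suc N) * (C[ suc N , suc k ] * sgn (suc k) * harmonic k)
  absorb k = begin
    C[ N , k ] * (sgn (suc k) * (+ 1 / suc k)) * harmonic k      ≡⟨ regroup₁ C[ N , k ] (sgn (suc k)) (+ 1 / suc k) (harmonic k) ⟩
    (C[ N , k ] * (+ 1 / suc k)) * sgn (suc k) * harmonic k      ≡⟨ cong (λ c → c * sgn (suc k) * harmonic k) (C[]-absorb-inverse N k) ⟩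
    ((+ 1 / suc N) * C[ suc N , suc k ]) * sgn (suc k) * harmonic k ≡⟨ regroup₂ (+ 1 / suc N) C[ suc N , suc k ] (sgn (suc k)) (harmonic k) ⟩
    (+ 1 / suc N) * (C[ suc N , suc k ] * sgn (suc k) * harmonic k) ∎
    where
    regroup₁ : ∀ b s i h → b * (s * i) * h ≡ (b * i) * s * h
    regroup₁ = solve-∀ ℚ-ring
    regroup₂ : ∀ i b s h → i * b * s * h ≡ i * (b * s * h)
    regroup₂ = solve-∀ ℚ-ring

harmonicBinomSum-pascal : ∀ n a → harmonicBinomSum (suc n) (suc a) ≡ harmonicBinomSum n (suc a) + harmonicBinomSum (suc n) a
harmonicBinomSum-pascal n a = begin
  ℕ→ℚ 2 * Σ₁ (suc n) (λ k → T (suc n ℕ.+ suc a) (k ℕ.+ suc a) k)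
    ≡⟨ cong (ℕ→ℚ 2 *_) (trans (Σ₁-cong-< (suc n) (λ k _ → split k)) (Σ₁-distrib-+ (suc n) _ _)) ⟩
  ℕ→ℚ 2 * ((X + T (n ℕ.+ suc a) (suc n ℕ.+ suc a) (suc n)) + Y)
    ≡⟨ cong (λ c → ℕ→ℚ 2 * ((X + c * w (suc n) * harmonic (suc n)) + Y)) (C[]-vanish (ℕP.n<1+n (n ℕ.+ suc a))) ⟩
  ℕ→ℚ 2 * ((X + 0ℚ * w (suc n) * harmonic (suc n)) + Y)
    ≡⟨ distribute X (w (suc n)) Y (harmonic (suc n)) ⟩
  harmonicBinomSum n (suc a) + harmonicBinomSum (suc n) a ∎
  where
  w : ℕ → ℚ
  w k = sgn (suc k) * (+ 1 / suc k)
  T : ℕ → ℕ → ℕ → ℚ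
  T m j k = C[ m , j ] * w k * harmonic k
  X = Σ₁ n (λ k → T (n ℕ.+ suc a) (k ℕ.+ suc a) k)
  Y = Σ₁ (suc n) (λ k → T (suc n ℕ.+ a) (k ℕ.+ a) k)
  distribute : ∀ x y z h → ℕ→ℚ 2 * ((x + 0ℚ * y * h) + z) ≡ ℕ→ℚ 2 * x + ℕ→ℚ 2 * z
  distribute = solve-∀ ℚ-ring
  split : ∀ k → T (suc n ℕ.+ suc a) (suc k ℕ.+ suc a) (suc k)
              ≡ T (n ℕ.+ suc a) (suc k ℕ.+ suc a) (suc k) + T (suc n ℕ.+ a) (suc k ℕ.+ a) (suc k)
  split k = begin
    C[ suc (n ℕ.+ suc a) , suc (k ℕ.+ suc a) ] * w (suc k) * harmonic (suc k)
      ≡⟨ cong (λ c → c * w (suc k) * harmonic (suc k)) (C[]-pascal (n ℕ.+ suc a) (k ℕ.+ suc a)) ⟩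
    (C[ n ℕ.+ suc a , k ℕ.+ suc a ] + C[ n ℕ.+ suc a , suc (k ℕ.+ suc a) ]) * w (suc k) * harmonic (suc k)
      ≡⟨ cong₂ (λ m j → (C[ m , j ] + C[ n ℕ.+ suc a , suc (k ℕ.+ suc a) ]) * w (suc k) * harmonic (suc k)) (ℕP.+-suc n a) (ℕP.+-suc k a) ⟩
    (C[ suc n ℕ.+ a , suc k ℕ.+ a ] + C[ n ℕ.+ suc a , suc k ℕ.+ suc a ]) * w (suc k) * harmonic (suc k)
      ≡⟨ expand C[ suc n ℕ.+ a , suc k ℕ.+ a ] C[ n ℕ.+ suc a , suc k ℕ.+ suc a ] (w (suc k)) (harmonic (suc k)) ⟩
    T (n ℕ.+ suc a) (suc k ℕ.+ suc a) (suc k) + T (suc n ℕ.+ a) (suc k ℕ.+ a) (suc k) ∎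
    where
    expand : ∀ x y z h → (x + y) * z * h ≡ y * z * h + x * z * h
    expand = solve-∀ ℚ-ring

hyperConv≡harmonicBinomSum : ∀ a n → hyperConv n (+ a) (+ 0) ≡ harmonicBinomSum n a
hyperConv≡harmonicBinomSum zero    n       = trans (hyperConv-0-0 n) (sym (harmonicBinomSum-0 n))
hyperConv≡harmonicBinomSum (suc a) zero    = sym (*-zeroʳ (ℕ→ℚ 2))
hyperConv≡harmonicBinomSum (suc a) (suc n) = begin
  hyperConv (suc n) (ℤ.suc (+ a)) (+ 0)                     ≡⟨ hyperConv-pascalˡ n (+ a) (+ 0) ⟩
  hyperConv n (+ suc a) (+ 0) + hyperConv (suc n) (+ a) (+ 0) ≡⟨ cong₂ _+_ (hyperConv≡harmonicBinomSum (suc a) n) (hyperConv≡harmonicBinomSum a (suc n)) ⟩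
  harmonicBinomSum n (suc a) + harmonicBinomSum (suc n) a    ≡⟨ harmonicBinomSum-pascal n a ⟨
  harmonicBinomSum (suc n) (suc a)                          ∎

ℤ-induction : (P : ℤ → Set) → P (+ 0) → (∀ c → P c → P (ℤ.suc c)) → (∀ c → P (ℤ.suc c) → P c) → ∀ c → P c
ℤ-induction P P0 up down (+ zero)       = P0
ℤ-induction P P0 up down (+ suc k)      = up (+ k) (ℤ-induction P P0 up down (+ k))
ℤ-induction P P0 up down -[1+ zero ]    = down -[1+ 0 ] P0
ℤ-induction P P0 up down -[1+ suc k ]   = down -[1+ suc k ] (ℤ-induction P P0 up down -[1+ k ])

-- Both sides satisfy the same recursion in c, so the identity spreads from c = 0 in both directions.
rising″≡!*hyperConv : ∀ N c → rising″ (ℤ→ℚ c) (suc N) ≡ ℕ→ℚ (suc N !) * hyperConv N c (+ 0)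
rising″≡!*hyperConv zero    c = both-zero (ℤ→ℚ c)
  where
  both-zero : ∀ s → (s + 0ℚ) * 0ℚ + ℕ→ℚ 2 * 0ℚ ≡ 1ℚ * 0ℚ
  both-zero = solve-∀ ℚ-ring
rising″≡!*hyperConv (suc N) = ℤ-induction P at-zero
  (λ c Pc → trans (rising″-step c) (trans (cong (_+ X c) Pc) (sym (hyperConv-step c))))
  (λ c Pc+1 → +-cancelʳ (X c) _ _ (trans (sym (rising″-step c)) (trans Pc+1 (hyperConv-step c))))
  where
  F = ℕ→ℚ (suc (suc N) !)
  P : ℤ → Set
  P c = rising″ (ℤ→ℚ c) (suc (suc N)) ≡ F * hyperConv (suc N) c (+ 0)
  X : ℤ → ℚ
  X c = F * hyperConv N (ℤ.suc c) (+ 0)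
  hyperConv-step : ∀ c → F * hyperConv (suc N) (ℤ.suc c) (+ 0) ≡ F * hyperConv (suc N) c (+ 0) + X c
  hyperConv-step c = trans (cong (F *_) (trans (hyperConv-pascalˡ N c (+ 0)) (+-comm (hyperConv N (ℤ.suc c) (+ 0)) _))) (*-distribˡ-+ F _ _)
  rising″-step : ∀ c → rising″ (ℤ→ℚ (ℤ.suc c)) (suc (suc N)) ≡ rising″ (ℤ→ℚ c) (suc (suc N)) + X c
  rising″-step c = begin
    rising″ (ℤ→ℚ (ℤ.suc c)) (suc (suc N))
      ≡⟨ cong (λ s → rising″ s (suc (suc N))) (ℤ→ℚ-suc c) ⟩
    rising″ (ℤ→ℚ c + 1ℚ) (suc (suc N))
      ≡⟨ rising″-pascal (ℤ→ℚ c) (suc N) ⟩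
    rising″ (ℤ→ℚ c) (suc (suc N)) + ℕ→ℚ (suc (suc N)) * rising″ (ℤ→ℚ c + 1ℚ) (suc N)
      ≡⟨ cong (λ s → rising″ (ℤ→ℚ c) (suc (suc N)) + ℕ→ℚ (suc (suc N)) * rising″ s (suc N)) (ℤ→ℚ-suc c) ⟨
    rising″ (ℤ→ℚ c) (suc (suc N)) + ℕ→ℚ (suc (suc N)) * rising″ (ℤ→ℚ (ℤ.suc c)) (suc N)
      ≡⟨ cong (λ d → rising″ (ℤ→ℚ c) (suc (suc N)) + ℕ→ℚ (suc (suc N)) * d) (rising″≡!*hyperConv N (ℤ.suc c)) ⟩
    rising″ (ℤ→ℚ c) (suc (suc N)) + ℕ→ℚ (suc (suc N)) * (ℕ→ℚ (suc N !) * hyperConv N (ℤ.suc c) (+ 0))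
      ≡⟨ cong (λ d → rising″ (ℤ→ℚ c) (suc (suc N)) + d)
              (trans (sym (*-assoc (ℕ→ℚ (suc (suc N))) _ _)) (cong (_* hyperConv N (ℤ.suc c) (+ 0)) (sym (ℕ→ℚ-homo-* (suc (suc N)) (suc N !))))) ⟩
    rising″ (ℤ→ℚ c) (suc (suc N)) + X c ∎
  at-zero : P (+ 0)
  at-zero = begin
    rising″ 0ℚ (suc (suc N))
      ≡⟨ rising″-0 (suc N) ⟩
    ℕ→ℚ 2 * ℕ→ℚ (suc N !) * harmonic (suc N)
      ≡⟨ insert (ℕ→ℚ 2 * ℕ→ℚ (suc N !) * harmonic (suc N)) (n*[1/n]≡1 (suc (suc N))) ⟩
    ℕ→ℚ 2 * ℕ→ℚ (suc N !) * harmonic (suc N) * (ℕ→ℚ (suc (suc N)) * (+ 1 / suc (suc N)))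
      ≡⟨ regroup (ℕ→ℚ 2) (ℕ→ℚ (suc N !)) (harmonic (suc N)) (ℕ→ℚ (suc (suc N))) (+ 1 / suc (suc N)) ⟩
    (ℕ→ℚ (suc (suc N)) * ℕ→ℚ (suc N !)) * (ℕ→ℚ 2 * (harmonic (suc N) * (+ 1 / suc (suc N))))
      ≡⟨ cong₂ _*_ (ℕ→ℚ-homo-* (suc (suc N)) (suc N !)) (hyperConv-0-0 (suc N)) ⟨
    F * hyperConv (suc N) (+ 0) (+ 0) ∎
    where
    insert : ∀ a {u} → u ≡ 1ℚ → a ≡ a * u
    insert a refl = sym (*-identityʳ a)
    regroup : ∀ a f h b i → a * f * h * (b * i) ≡ (b * f) * (a * (h * i))
    regroup = solve-∀ ℚ-ring

applyRising-bernoulliWeight≡!*hyperConv : ∀ n c M Y → M + (- Y) ≡ ℤ→ℚ c →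
  applyRising (bernoulliWeight Y) M n 0 ≡ ℕ→ℚ (n !) * hyperConv n c (+ 0)
applyRising-bernoulliWeight≡!*hyperConv n c M Y M-Y≡c = ℕ→ℚ-*-cancelˡ (suc n) (begin
  ℕ→ℚ (suc n) * applyRising (bernoulliWeight Y) M n 0     ≡⟨ applyRising-bernoulliWeight Y M n ⟩
  rising″ (M + (- Y)) (suc n)                             ≡⟨ cong (λ s → rising″ s (suc n)) M-Y≡c ⟩
  rising″ (ℤ→ℚ c) (suc n)                                 ≡⟨ rising″≡!*hyperConv n c ⟩
  ℕ→ℚ (suc n !) * hyperConv n c (+ 0)                     ≡⟨ cong (_* hyperConv n c (+ 0)) (ℕ→ℚ-homo-* (suc n) (n !)) ⟩
  ℕ→ℚ (suc n) * ℕ→ℚ (n !) * hyperConv n c (+ 0)           ≡⟨ *-assoc (ℕ→ℚ (suc n)) _ _ ⟩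
  ℕ→ℚ (suc n) * (ℕ→ℚ (n !) * hyperConv n c (+ 0))         ∎)

Σ-stirling-bernoulli≡applyRising : ∀ n m Y →
  Σ₁ n (λ k → sgn (suc k) * ℕ→ℚ (rStirling₁ n k m) * ℕ→ℚ k * bernoulliPoly (k ∸ 1) Y)
    ≡ applyRising (bernoulliWeight Y) (ℕ→ℚ m) n 0
Σ-stirling-bernoulli≡applyRising n m Y = begin
  Σ₁ n (λ k → sgn (suc k) * ℕ→ℚ (rStirling₁ n k m) * ℕ→ℚ k * bernoulliPoly (k ∸ 1) Y)
    ≡⟨ Σ₁-cong n term ⟩
  Σ₁ n (λ k → risingCoeff n k M * bernoulliWeight Y (k ℕ.+ 0))
    ≡⟨ add-zero (Σ₁ n (λ k → risingCoeff n k M * bernoulliWeight Y (k ℕ.+ 0))) (risingCoeff n 0 M) (sgn 1) (bernoulliPoly 0 Y) ⟩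
  risingCoeff n 0 M * bernoulliWeight Y 0 + Σ₁ n (λ k → risingCoeff n k M * bernoulliWeight Y (k ℕ.+ 0))
    ≡⟨ Σ₀≡f0+Σ₁ n (λ k → risingCoeff n k M * bernoulliWeight Y (k ℕ.+ 0)) ⟨
  Σ₀ n (λ k → risingCoeff n k M * bernoulliWeight Y (k ℕ.+ 0))
    ≡⟨ Σ-risingCoeff≡applyRising (bernoulliWeight Y) M n 0 ⟩
  applyRising (bernoulliWeight Y) M n 0 ∎
  where
  M = ℕ→ℚ m
  add-zero : ∀ x r s b → x ≡ r * (s * 0ℚ * b) + x
  add-zero = solve-∀ ℚ-ring
  regroup : ∀ a b c d → a * b * c * d ≡ b * (a * c * d)
  regroup = solve-∀ ℚ-ring
  term : ∀ k → sgn (suc k) * ℕ→ℚ (rStirling₁ n k m) * ℕ→ℚ k * bernoulliPoly (k ∸ 1) Y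
             ≡ risingCoeff n k M * bernoulliWeight Y (k ℕ.+ 0)
  term k = begin
    sgn (suc k) * ℕ→ℚ (rStirling₁ n k m) * ℕ→ℚ k * bernoulliPoly (k ∸ 1) Y
      ≡⟨ cong (λ r → sgn (suc k) * r * ℕ→ℚ k * bernoulliPoly (k ∸ 1) Y) (rStirling₁≡risingCoeff m n k) ⟩
    sgn (suc k) * risingCoeff n k M * ℕ→ℚ k * bernoulliPoly (k ∸ 1) Y
      ≡⟨ regroup (sgn (suc k)) (risingCoeff n k M) (ℕ→ℚ k) (bernoulliPoly (k ∸ 1) Y) ⟩
    risingCoeff n k M * bernoulliWeight Y k
      ≡⟨ cong (λ j → risingCoeff n k M * bernoulliWeight Y j) (ℕP.+-identityʳ k) ⟨
    risingCoeff n k M * bernoulliWeight Y (k ℕ.+ 0) ∎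

Σ₀-hyper-suc≡hyperConv : ∀ n A B → Σ₀ n (λ l → hyper A (suc l) * hyper B (n ∸ l)) ≡ hyperConv n A B
Σ₀-hyper-suc≡hyperConv n A B = begin
  Σ₀ n (λ l → hyper A (suc l) * hyper B (n ∸ l))                   ≡⟨ Σ₀-suc≡Σ₁ n (λ k → hyper A k * hyper B (suc n ∸ k)) ⟩
  hyperConv n A B + hyper A (suc n) * hyper B (n ∸ n)               ≡⟨ cong (λ e → hyperConv n A B + hyper A (suc n) * hyper B e) (ℕP.n∸n≡0 n) ⟩
  hyperConv n A B + hyper A (suc n) * 0ℚ                            ≡⟨ drop (hyperConv n A B) (hyper A (suc n)) ⟩
  hyperConv n A B                                                   ∎
  where
  drop : ∀ c h → c + h * 0ℚ ≡ c
  drop = solve-∀ ℚ-ring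

bernoulli-argument : ∀ m r → ℕ→ℚ m + (- ℤ→ℚ (+ m - + (2 ℕ.* r) ℤ.+ + 1)) ≡ ℤ→ℚ ((+ r - + 1) ℤ.+ + r)
bernoulli-argument m r = begin
  ℕ→ℚ m + (- ℤ→ℚ (+ m - + (2 ℕ.* r) ℤ.+ + 1))                 ≡⟨ cong (λ y → ℕ→ℚ m + (- y)) cast-argument ⟩
  ℕ→ℚ m + (- ((ℕ→ℚ m + (- (ℕ→ℚ 2 * ℕ→ℚ r))) + 1ℚ))           ≡⟨ simplify (ℕ→ℚ m) (ℕ→ℚ r) ⟩
  (ℕ→ℚ r + (- 1ℚ)) + ℕ→ℚ r                                   ≡⟨ cast-shift ⟨
  ℤ→ℚ ((+ r - + 1) ℤ.+ + r)                                   ∎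
  where
  cast-argument : ℤ→ℚ (+ m - + (2 ℕ.* r) ℤ.+ + 1) ≡ (ℕ→ℚ m + (- (ℕ→ℚ 2 * ℕ→ℚ r))) + 1ℚ
  cast-argument = trans (ℤ→ℚ-homo-+ (+ m - + (2 ℕ.* r)) (+ 1)) (cong (_+ 1ℚ)
    (trans (ℤ→ℚ-homo-+ (+ m) (ℤ.- + (2 ℕ.* r))) (cong (λ y → ℕ→ℚ m + y)
      (trans (ℤ→ℚ-homo-neg (+ (2 ℕ.* r))) (cong -_ (ℕ→ℚ-homo-* 2 r))))))
  cast-shift : ℤ→ℚ ((+ r - + 1) ℤ.+ + r) ≡ (ℕ→ℚ r + (- 1ℚ)) + ℕ→ℚ r
  cast-shift = trans (ℤ→ℚ-homo-+ (+ r - + 1) (+ r)) (cong (_+ ℕ→ℚ r) (ℤ→ℚ-homo-+ (+ r) (ℤ.- + 1)))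
  simplify : ∀ m r → m + (- ((m + (- (ℕ→ℚ 2 * r))) + 1ℚ)) ≡ (r + (- 1ℚ)) + r
  simplify = solve-∀ ℚ-ring

mainTheorem6 : (n r s : ℕ) →
    (Σ₁ n (λ k → hyper (+ r) k * hyper (+ s) (suc n Data.Nat.∸ k))
      ≡ ℕ→ℚ 2 * Σ₁ n (λ k → ℕ→ℚ ((n Data.Nat.+ r Data.Nat.+ s) C (k Data.Nat.+ r Data.Nat.+ s)) * (sgn (suc k) * (+ 1 / suc k)) * harmonic k))
    × ((m : ℕ) →
      Σ₀ n (λ l → hyper (+ r - + 1) (suc l) * hyper (+ r) (n Data.Nat.∸ l))
        ≡ (+ 1 / (n !)) {{n !≢0}} * Σ₁ n (λ k → sgn (suc k) * ℕ→ℚ (rStirling₁ n k m) * ℕ→ℚ k * bernoulliPoly (k Data.Nat.∸ 1) (ℤ→ℚ (+ m - + (2 Data.Nat.* r) Data.Integer.+ + 1))))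
mainTheorem6 n r s = harmonic-form , stirling-bernoulli-form
  where
  Y : ℕ → ℚ
  Y m = ℤ→ℚ (+ m - + (2 ℕ.* r) ℤ.+ + 1)
  c : ℤ
  c = (+ r - + 1) ℤ.+ + r
  harmonic-form : hyperConv n (+ r) (+ s)
    ≡ ℕ→ℚ 2 * Σ₁ n (λ k → C[ n ℕ.+ r ℕ.+ s , k ℕ.+ r ℕ.+ s ] * (sgn (suc k) * (+ 1 / suc k)) * harmonic k)
  harmonic-form = begin
    hyperConv n (+ r) (+ s)             ≡⟨ hyperConv-collect n (+ r) s ⟩
    hyperConv n (+ (r ℕ.+ s)) (+ 0)     ≡⟨ hyperConv≡harmonicBinomSum (r ℕ.+ s) n ⟩
    harmonicBinomSum n (r ℕ.+ s)        ≡⟨ cong (ℕ→ℚ 2 *_) (Σ₁-cong n (λ k → cong₂ (λ a b → C[ a , b ] * (sgn (suc k) * (+ 1 / suc k)) * harmonic k)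
                                                                            (sym (ℕP.+-assoc n r s)) (sym (ℕP.+-assoc k r s)))) ⟩
    ℕ→ℚ 2 * Σ₁ n (λ k → C[ n ℕ.+ r ℕ.+ s , k ℕ.+ r ℕ.+ s ] * (sgn (suc k) * (+ 1 / suc k)) * harmonic k) ∎
  1/n! : ℚ
  1/n! = (+ 1 / (n !)) {{n !≢0}}
  stirling-bernoulli-form : ∀ m → Σ₀ n (λ l → hyper (+ r - + 1) (suc l) * hyper (+ r) (n ∸ l))
    ≡ 1/n! * Σ₁ n (λ k → sgn (suc k) * ℕ→ℚ (rStirling₁ n k m) * ℕ→ℚ k * bernoulliPoly (k ∸ 1) (Y m))
  stirling-bernoulli-form m = begin
    Σ₀ n (λ l → hyper (+ r - + 1) (suc l) * hyper (+ r) (n ∸ l))  ≡⟨ Σ₀-hyper-suc≡hyperConv n (+ r - + 1) (+ r) ⟩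
    hyperConv n (+ r - + 1) (+ r)                                 ≡⟨ hyperConv-collect n (+ r - + 1) r ⟩
    hyperConv n c (+ 0)                                           ≡⟨ [1/n]*[n*x]≡x (n !) {{n !≢0}} (hyperConv n c (+ 0)) ⟨
    1/n! * (ℕ→ℚ (n !) * hyperConv n c (+ 0))
      ≡⟨ cong (1/n! *_) (applyRising-bernoulliWeight≡!*hyperConv n c (ℕ→ℚ m) (Y m) (bernoulli-argument m r)) ⟨
    1/n! * applyRising (bernoulliWeight (Y m)) (ℕ→ℚ m) n 0
      ≡⟨ cong (1/n! *_) (Σ-stirling-bernoulli≡applyRising n m (Y m)) ⟨
    1/n! * Σ₁ n (λ k → sgn (suc k) * ℕ→ℚ (rStirling₁ n k m) * ℕ→ℚ k * bernoulliPoly (k ∸ 1) (Y m)) ∎
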